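{- Let $F$ be a figure with an equilibrium function $eq$ and associated set $\mathcal{H}_F$ of height functions, and let $h,h'\in\mathcal{H}_F$. Then $h\le h'$ (pointwise) if and only if $G_h\le_{flip^+}G_{h'}$. Moreover, in this case one can pass from $G_h$ to $G_{h'}$ by a sequence of $\Delta(h,h')/4$ upward flips.
   Context: Square grid $\Lambda$ with vertices $\mathbb{Z}^2$, unit edges, unit square cells coloured black/white as a checkerboard. A figure $F$ is a finite 4-connected union of cells. $H_\infty$ is the unbounded 8-connected component of $\mathbb{R}^2\setminus F$. Every vertex all of whose incident edges lie on the boundary of $F$ (two cells of $F$ meeting only at that corner) is replaced by two copies, each adjacent to the two neighbours lying on one of these cells. $G_F=(V_F,E_F)$: vertices are corners of cells of $F$ (after duplication), arcs are both orientations of each side of each cell of $F$; $E_b(F)$: arcs whose edge lies on the boundary of $F$; others interior. For $g:E_F\to\mathbb{Z}$ and a path $P$, $g(P)$ is the sum of $g$ over arcs of $P$; $D(h)(v,v')=h(v')-h(v)$. Spin: $sp(v,v')=1$ if moving from $v$ to $v'$ there is a white cell on the left, $-1$ otherwise. $Dis_F(C)$ for an elementary clockwise cycle: black minus white cells of $F$ enclosed. An equilibrium function is a skew-symmetric $eq:E_F\to\mathbb{Z}$ with $sp(C)+eq(C)=4Dis_F(C)$ for all elementary clockwise cycles $C$. $\mathbf{t}(a)=eq(a)-sp(a)+2$, $\mathbf{b}(a)=eq(a)-sp(a)-2$ for interior arcs, $\mathbf{t}(a)=\mathbf{b}(a)=eq(a)+sp(a)$ on $E_b(F)$. Fix $w_0\in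 V_F$ on the boundary of $H_\infty$; $\mathcal{H}_F$ is the set of $h:V_F\to\mathbb{Z}$ with $h(w_0)=0$ and $D(h)(a)\in\{\mathbf{b}(a),\mathbf{t}(a)\}$ for all $a$. An elementary cycle $C$ is critical if $\mathbf{t}(C)=0$. Forced components are the classes of the equivalence relation on $V_F$ ("critical equivalence") under which vertices lying on a common critical cycle are equivalent; $U_\infty$ is the forced component containing $w_0$. Choose one vertex $v_U$ in each forced component $U$ and set $\Delta(h,h')=\sum_U|h(v_U)-h'(v_U)|$. For $h\in\mathcal{H}_F$, $G_h$ is the directed graph whose vertices are the forced components, with an arc $(U,U')$ iff $U\ne U'$ and there is an arc $(v,v')\in E_F$ with $v\in U$, $v'\in U'$ and $D(h)(v,v')=\mathbf{t}(v,v')$. If $U\ne U_\infty$ has no incoming arc in $G_h$, the upward flip in $U$ transforms $G_h$ into the graph obtained by reversing all arcs incident to $U$ (a downward flip is defined likewise when $U$ has no outgoing arc). $G\le_{flip^+}G'$ means there is a sequence $G=G_0,G_1,\dots,G_p=G'$ of graphs of the form $G_{h_i}$, $h_i\in\mathcal{H}_F$, each obtained from the previous one by an upward flip. -}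

module Defs where

open import Data.Bool using (Bool; true; false; _∧_; _∨_; not; if_then_else_; T; _xor_)
open import Data.Nat as ℕ using (ℕ; zero; suc; _%_; _≡ᵇ_)
open import Data.Integer as ℤ using (ℤ; +_; _+_; _-_; _*_; -_; ∣_∣)
open import Data.Product using (Σ; _×_; _,_; proj₁; proj₂)
open import Data.Sum using (_⊎_)
open import Data.List using (List; []; _∷_; map; zip; _++_; [_]; length; foldr)
open import Data.Bool.ListAction using (any)
open import Data.List.Relation.Unary.Any using (Any)
open import Data.List.Relation.Unary.All using (All)
open import Data.List.Relation.Unary.Unique.Propositional using (Unique)
open import Data.List.Relation.Unary.AllPairs using (AllPairs)
open import Data.List.Membership.Propositional using (_∈_)
open import Relation.Binary.PropositionalEquality using (_≡_)
open import Relation.Nullary using (¬_)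
open import Relation.Nullary.Decidable using (⌊_⌋)
open import Relation.Binary.Construct.Closure.ReflexiveTransitive using (Star)
open import Function.Bundles using (_⇔_)

Point : Set
Point = ℤ × ℤ

-- the cell (i , j) is the unit square [i,i+1] × [j,j+1]
Cell : Set
Cell = ℤ × ℤ

infix 4 _==ℤ_ _<ℤ_ _==ᶜ_ _==q_

_==ℤ_ : ℤ → ℤ → Bool
x ==ℤ y = ⌊ x ℤ.≟ y ⌋

_<ℤ_ : ℤ → ℤ → Bool
x <ℤ y = ⌊ x ℤ.<? y ⌋

_==ᶜ_ : Cell → Cell → Bool
(i , j) ==ᶜ (i' , j') = (i ==ℤ i') ∧ (j ==ℤ j')

isBlack : Cell → Bool
isBlack (i , j) = (∣ i + j ∣ % 2) ≡ᵇ 0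

colourSign : Cell → ℤ
colourSign c = if isBlack c then + 1 else - + 1

sumℤ : List ℤ → ℤ
sumℤ = foldr _+_ (+ 0)

inF : List Cell → Cell → Bool
inF cs c = any (_==ᶜ c) cs

Adj4 : Cell → Cell → Set
Adj4 (i , j) (i' , j') = ∣ i - i' ∣ ℕ.+ ∣ j - j' ∣ ≡ 1

Adj8 : Cell → Cell → Set
Adj8 (i , j) (i' , j') =
  ¬ ((i , j) ≡ (i' , j')) × (∣ i - i' ∣ ℕ.≤ 1) × (∣ j - j' ∣ ℕ.≤ 1)

Step4 : List Cell → Cell → Cell → Set
Step4 cs c c' = T (inF cs c') × Adj4 c c'

record Figure : Set where
  field
    cells     : List Cell
    distinct  : Unique cells
    connected : ∀ c c' → T (inF cells c) → T (inF cells c') →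
                Star (Step4 cells) c c'
open Figure public

Step8 : List Cell → Cell → Cell → Set
Step8 cs c c' = T (not (inF cs c')) × Adj8 c c'

InHinf : Figure → Cell → Set
InHinf F c = T (not (inF (cells F) c)) ×
  (∀ (N : ℕ) → Σ Cell λ c' → Star (Step8 (cells F)) c c' ×
                  (N ℕ.≤ ∣ proj₁ c' ∣ ⊎ N ℕ.≤ ∣ proj₂ c' ∣))

data Quad : Set where
  NE NW SW SE : Quad

quadℕ : Quad → ℕ
quadℕ NE = 0
quadℕ NW = 1
quadℕ SW = 2
quadℕ SE = 3

_==q_ : Quad → Quad → Bool
q ==q q' = quadℕ q ≡ᵇ quadℕ q'

cellAt : Point → Quad → Cell
cellAt (x , y) NE = (x , y)
cellAt (x , y) NW = (x - + 1 , y)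
cellAt (x , y) SW = (x - + 1 , y - + 1)
cellAt (x , y) SE = (x , y - + 1)

data Corner : Set where
  LL UL UR LR : Corner

nextC : Corner → Corner
nextC LL = UL
nextC UL = UR
nextC UR = LR
nextC LR = LL

corner : Cell → Corner → Point
corner (i , j) LL = (i , j)
corner (i , j) UL = (i , j + + 1)
corner (i , j) UR = (i + + 1 , j + + 1)
corner (i , j) LR = (i + + 1 , j)

-- position of the cell relative to its corner
quadOf : Corner → Quad
quadOf LL = NE
quadOf UL = SE
quadOf UR = SW
quadOf LR = NW

-- the four grid edges at p go right (NE|SE), up (NE|NW), left (NW|SW),
-- down (SW|SE); an edge is on the boundary of F iff exactly one of its
-- two cells is in F.  pinch: all four incident edges on the boundary.
pinch : List Cell → Point → Bool
pinch cs p =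
  (f NE xor f SE) ∧ (f NE xor f NW) ∧ (f NW xor f SW) ∧ (f SW xor f SE)
  where f : Quad → Bool
        f q = inF cs (cellAt p q)

-- canonical quadrant used to name a non-duplicated vertex
minQuad : List Cell → Point → Quad
minQuad cs p =
  if inF cs (cellAt p NE) then NE else
  if inF cs (cellAt p NW) then NW else
  if inF cs (cellAt p SW) then SW else SE

-- (p , q) names a vertex of G_F: the point p with a cell of F in
-- quadrant q; if p is a pinch point the two copies are told apart by
-- q, otherwise q is the canonical quadrant.
isVertex : List Cell → Point × Quad → Bool
isVertex cs (p , q) =
  inF cs (cellAt p q) ∧ (pinch cs p ∨ (q ==q minQuad cs p))

V : Figure → Set
V F = Σ (Point × Quad) (λ x → T (isVertex (cells F) x))

pt : {F : Figure} → V F → Point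
pt v = proj₁ (proj₁ v)

vtxRaw : List Cell → Cell → Corner → Point × Quad
vtxRaw cs c k = (p , (if pinch cs p then quadOf k else minQuad cs p))
  where p = corner c k

-- (v , v') is an arc of E_F: an orientation of a side of a cell of F
Arc : (F : Figure) → V F → V F → Set
Arc F v v' = Σ Cell λ c → T (inF (cells F) c) × Σ Corner λ k →
  (proj₁ v ≡ vtxRaw (cells F) c k × proj₁ v' ≡ vtxRaw (cells F) c (nextC k))
  ⊎ (proj₁ v ≡ vtxRaw (cells F) c (nextC k) × proj₁ v' ≡ vtxRaw (cells F) c k)

-- the cell on the left when moving along a unit edge from p to p'
leftCell : Point → Point → Cell
leftCell (x , y) (x' , y') =
  if x' ==ℤ (x + + 1) then (x , y) else
  if x' ==ℤ (x - + 1) then (x - + 1 , y - + 1) else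
  if y' ==ℤ (y + + 1) then (x - + 1 , y) else (x , y - + 1)

spP : Point → Point → ℤ
spP p p' = if isBlack (leftCell p p') then - + 1 else + 1

sp : (F : Figure) → V F → V F → ℤ
sp F v v' = spP (pt {F} v) (pt {F} v')

isBoundary : (F : Figure) → V F → V F → Bool
isBoundary F v v' =
  inF (cells F) (leftCell p p') xor inF (cells F) (leftCell p' p)
  where p = pt {F} v
        p' = pt {F} v'

tA : (F : Figure) → (V F → V F → ℤ) → V F → V F → ℤ
tA F eq v v' = if isBoundary F v v' then eq v v' + sp F v v'
               else (eq v v' - sp F v v') + + 2

bA : (F : Figure) → (V F → V F → ℤ) → V F → V F → ℤ
bA F eq v v' = if isBoundary F v v' then eq v v' + sp F v v'
               else (eq v v' - sp F v v') - + 2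

D : {F : Figure} → (V F → ℤ) → V F → V F → ℤ
D h v v' = h v' - h v

cyc : {A : Set} → List A → List (A × A)
cyc [] = []
cyc (x ∷ xs) = zip (x ∷ xs) (xs ++ [ x ])

sumArcs : {A : Set} → (A → A → ℤ) → List A → ℤ
sumArcs g C = sumℤ (map (λ e → g (proj₁ e) (proj₂ e)) (cyc C))

ElemCycle : (F : Figure) → List (V F) → Set
ElemCycle F C = (2 ℕ.≤ length C) × Unique C ×
                All (λ e → Arc F (proj₁ e) (proj₂ e)) (cyc C)

-- twice the signed (shoelace) area of the closed polygonal line
area2 : List Point → ℤ
area2 ps = sumℤ (map (λ e → (proj₁ (proj₁ e) * proj₂ (proj₂ e))
                            - (proj₁ (proj₂ e) * proj₂ (proj₁ e))) (cyc ps))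

points : {F : Figure} → List (V F) → List Point
points {F} C = map (pt {F}) C

Clockwise : (F : Figure) → List (V F) → Set
Clockwise F C = area2 (points {F} C) ℤ.< + 0

-- winding number of the closed lattice path around the centre of cell
-- (i , j): signed crossings of the horizontal ray going right
crossing : Cell → Point × Point → ℤ
crossing (i , j) ((x , y) , (x' , y')) =
  if (x ==ℤ x') ∧ (i <ℤ x) then
    (if (y ==ℤ j) ∧ (y' ==ℤ (j + + 1)) then + 1 else
     if (y ==ℤ (j + + 1)) ∧ (y' ==ℤ j) then - + 1 else + 0)
  else + 0

wind : List Point → Cell → ℤ
wind ps c = sumℤ (map (crossing c) (cyc ps))

Dis : (F : Figure) → List (V F) → ℤ
Dis F C = sumℤ (map (λ c → if wind (points {F} C) c ==ℤ + 0 then + 0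
                            else colourSign c) (cells F))

Equilibrium : (F : Figure) → (V F → V F → ℤ) → Set
Equilibrium F eq =
  (∀ v v' → Arc F v v' → eq v' v ≡ - eq v v') ×
  (∀ C → ElemCycle F C → Clockwise F C →
     sumArcs (sp F) C + sumArcs eq C ≡ + 4 * Dis F C)

OnBoundaryHinf : (F : Figure) → V F → Set
OnBoundaryHinf F w0 = Σ Quad λ q → InHinf F (cellAt (pt {F} w0) q)

IsHeight : (F : Figure) → (V F → V F → ℤ) → V F → (V F → ℤ) → Set
IsHeight F eq w0 h =
  (h w0 ≡ + 0) ×
  (∀ v v' → Arc F v v' → D {F} h v v' ≡ bA F eq v v' ⊎ D {F} h v v' ≡ tA F eq v v')

Critical : (F : Figure) → (V F → V F → ℤ) → List (V F) → Set
Critical F eq C = ElemCycle F C × sumArcs (tA F eq) C ≡ + 0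

CritStep : (F : Figure) → (V F → V F → ℤ) → V F → V F → Set
CritStep F eq v v' = Σ (List (V F)) λ C → Critical F eq C × v ∈ C × v' ∈ C

CritEquiv : (F : Figure) → (V F → V F → ℤ) → V F → V F → Set
CritEquiv F eq v v' = Star (CritStep F eq) v v'

-- The graphs G_h and flips.  A graph on forced components is encoded as
-- a relation on vertices (u , u') meaning an arc from the component of
-- u to the component of u'.

Graph : Figure → Set₁
Graph F = V F → V F → Set

GH : (F : Figure) → (V F → V F → ℤ) → (V F → ℤ) → Graph F
GH F eq h u u' = ¬ (CritEquiv F eq u u') ×
  Σ (V F) λ v → Σ (V F) λ v' → Arc F v v' ×
    CritEquiv F eq v u × CritEquiv F eq v' u' × D {F} h v v' ≡ tA F eq v v'

SameGraph : (F : Figure) → Graph F → Graph F → Set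
SameGraph F G G' = ∀ u u' → G u u' ⇔ G' u u'

UpFlip : (F : Figure) → (V F → V F → ℤ) → V F → Graph F → Graph F → Set
UpFlip F eq w0 G G' = Σ (V F) λ u →
  ¬ (CritEquiv F eq u w0) × (∀ v → ¬ G v u) ×
  (∀ v v' → G' v v' ⇔
     (((CritEquiv F eq v u ⊎ CritEquiv F eq v' u) × G v' v) ⊎
      (¬ CritEquiv F eq v u × ¬ CritEquiv F eq v' u × G v v')))

data FlipPath (F : Figure) (eq : V F → V F → ℤ) (w0 : V F) :
       Graph F → Graph F → ℕ → Set₁ where
  done : ∀ {G G'} → SameGraph F G G' → FlipPath F eq w0 G G' 0
  step : ∀ {G G' n} (h₁ : V F → ℤ) → IsHeight F eq w0 h₁ →
         UpFlip F eq w0 G (GH F eq h₁) →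
         FlipPath F eq w0 (GH F eq h₁) G' n → FlipPath F eq w0 G G' (suc n)

FlipLE : (F : Figure) → (V F → V F → ℤ) → V F → (V F → ℤ) → (V F → ℤ) → Set₁
FlipLE F eq w0 h h' = Σ ℕ λ p → FlipPath F eq w0 (GH F eq h) (GH F eq h') p

-- Δ(h , h') w.r.t. a choice of one vertex in each forced component

Representatives : (F : Figure) → (V F → V F → ℤ) → List (V F) → Set
Representatives F eq reps =
  (∀ v → Any (λ u → CritEquiv F eq v u) reps) ×
  AllPairs (λ u u' → ¬ CritEquiv F eq u u') reps

Δ : {F : Figure} → List (V F) → (V F → ℤ) → (V F → ℤ) → ℕ
Δ reps h h' = foldr ℕ._+_ 0 (map (λ u → ∣ h u - h' u ∣) reps)

module Submission where

-- Along every arc a height function h has D(h) ∈ {b, t} where t - b ∈ {0, 4}; hence D(h) ≤ t, and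
-- h' - h is a multiple of 4 for any two height functions.  On a critical cycle Σ D(h) = 0 = Σ t, so
-- every arc of it is tight (D(h) = t): the forced components are the strongly connected classes of
-- the tight arcs of any height function, h' - h is constant on each of them, and G_h is the quotient
-- of the tight arcs.  Adding 4 to h on a component U ≠ U∞ without incoming arc in G_h gives a height
-- function whose graph is the upward flip of G_h at U; since G_h determines h, every upward flip
-- raises h, and a flip sequence from G_h to G_h' forces h ≤ h'.  Conversely, if h ≤ h' and h ≠ h',
-- take a source component of G_h from which a vertex with h < h' is reachable by tight arcs.  As
-- h' - h cannot increase along tight arcs of h, it is ≥ 4 on that source, so the flip there stays
-- below h' and lowers Δ(h, h') by exactly 4.

open import Data.Bool using (Bool; true; false; T; not; _∨_; if_then_else_)
open import Data.Bool.Properties using (T?; T-≡; T-∧; T-∨; T-irrelevant; not-involutive; xor-comm; ∧-zeroʳ)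
open import Data.Nat as ℕ using (ℕ; zero; suc; z≤n; s≤s; _*_)
import Data.Nat.Properties as ℕ
open import Data.Nat.ListAction using (sum)
open import Data.Nat.Induction using (<-wellFounded)
open import Data.Integer as ℤ using (ℤ; +_; -[1+_]; _+_; _-_; -_; ∣_∣; _≤_; +≤+)
import Data.Integer.Properties as ℤ
open import Data.Integer.Solver using (module +-*-Solver)
open +-*-Solver using (solve; _:+_; _:-_; :-_; _:*_; con; _:=_)
open import Data.Product using (Σ; _×_; _,_; proj₁; proj₂; uncurry′)
open import Data.Product.Properties using (≡-dec)
open import Data.Sum using (_⊎_; inj₁; inj₂)
open import Data.Unit using (⊤; tt)
open import Data.Empty using (⊥-elim)
open import Data.List using (List; []; _∷_; _++_; [_]; map; zip; length; concatMap; filter)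
open import Data.List.Relation.Unary.Any using (Any; here; there; any?; satisfied)
import Data.List.Relation.Unary.Any.Properties as Any
open import Data.List.Relation.Unary.All as All using (All; []; _∷_)
import Data.List.Relation.Unary.All.Properties as All
open import Data.List.Relation.Unary.AllPairs using (AllPairs; []; _∷_)
open import Data.List.Relation.Unary.Unique.Propositional using (Unique)
open import Data.List.Membership.Propositional using (_∈_; _∉_; find; lose)
open import Data.List.Membership.Propositional.Properties using (∈-∃++; ∈-map⁺; ∈-concatMap⁺)
import Data.List.Membership.DecPropositional as DecMembership
open import Relation.Binary.PropositionalEquality hiding ([_])
open import Relation.Binary.Definitions using (DecidableEquality; Decidable)
open import Relation.Binary.Structures using (IsEquivalence)
open import Function using (_∘_)
open import Relation.Nullary using (¬_; Dec; yes; no)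
open import Relation.Nullary.Decidable using (toWitness; map′; _×-dec_; _⊎-dec_; ¬?)
open import Relation.Binary.Construct.Closure.ReflexiveTransitive using (Star; ε; _◅_; _◅◅_; reverse)
open import Function.Bundles using (_⇔_; mk⇔; Equivalence)
open import Induction.WellFounded using (Acc; acc)

open import Algebra.Properties.AbelianGroup ℤ.+-0-abelianGroup using () renaming (∙-cancelˡ to +-cancelˡ-≡)
open import Algebra.Properties.CommutativeSemigroup ℕ.+-commutativeSemigroup using () renaming (xy∙z≈xz∙y to +-right-comm)

open import Defs

+-cancelʳ-≤ : ∀ c {a b} → a + c ≤ b + c → a ≤ b
+-cancelʳ-≤ c {a} {b} a+c≤b+c =
  subst₂ _≤_ (+-minus c a) (+-minus c b) (ℤ.+-monoˡ-≤ (- c) a+c≤b+c)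
  where
    +-minus : ∀ c a → (a + c) - c ≡ a
    +-minus = solve 2 (λ c a → (a :+ c) :- c := a) refl

+1-1 : ∀ x → (x + + 1) - + 1 ≡ x
+1-1 = solve 1 (λ x → (x :+ con (+ 1)) :- con (+ 1) := x) refl

-1+1 : ∀ x → (x - + 1) + + 1 ≡ x
-1+1 = solve 1 (λ x → (x :- con (+ 1)) :+ con (+ 1) := x) refl

x≢x+d : ∀ x d → d ≢ + 0 → x ≢ x + d
x≢x+d x d d≢0 x≡x+d = d≢0 (begin
  d             ≡⟨ solve 2 (λ x d → d := (x :+ d) :- x) refl x d ⟩
  (x + d) - x   ≡⟨ cong (_- x) (sym x≡x+d) ⟩
  x - x         ≡⟨ ℤ.+-inverseʳ x ⟩
  + 0           ∎)
  where open ≡-Reasoning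

x≢x+1 : ∀ x → x ≢ x + + 1
x≢x+1 x = x≢x+d x (+ 1) λ ()

x≢x-1 : ∀ x → x ≢ x - + 1
x≢x-1 x = x≢x+d x (- + 1) λ ()

x≢x+1+1 : ∀ x → x ≢ (x + + 1) + + 1
x≢x+1+1 x x≡ = x≢x+d x (+ 2) (λ ()) (trans x≡ (ℤ.+-assoc x (+ 1) (+ 1)))

abs≡1 : ∀ z → ∣ z ∣ ≡ 1 → z ≡ + 1 ⊎ z ≡ - + 1
abs≡1 (+ 1) _ = inj₁ refl
abs≡1 -[1+ 0 ] _ = inj₂ refl

solve-for : ∀ x y {d} → x - y ≡ d → y ≡ x - d
solve-for x y refl = solve 2 (λ x y → y := x :- (x :- y)) refl x y

diff-mono : ∀ a b a′ b′ → b′ - a′ ≤ b - a → b′ - b ≤ a′ - a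
diff-mono a b a′ b′ le = subst₂ _≤_ (sym rearranged) (ℤ.+-identityʳ (a′ - a))
  (ℤ.+-monoʳ-≤ (a′ - a) (ℤ.i≤j⇒i-j≤0 le))
  where
    rearranged : b′ - b ≡ (a′ - a) + ((b′ - a′) - (b - a))
    rearranged = solve 4 (λ a b a′ b′ → b′ :- b := (a′ :- a) :+ ((b′ :- a′) :- (b :- a))) refl a b a′ b′

diff-swap : ∀ a b a′ b′ → b - a ≡ b′ - a′ → a′ - a ≡ b′ - b
diff-swap a b a′ b′ e = begin
  a′ - a                              ≡⟨ solve 4 (λ a b a′ b′ → a′ :- a := (b′ :- b) :+ ((b :- a) :- (b′ :- a′))) refl a b a′ b′ ⟩
  (b′ - b) + ((b - a) - (b′ - a′))    ≡⟨ cong (λ z → (b′ - b) + (z - (b′ - a′))) e ⟩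
  (b′ - b) + ((b′ - a′) - (b′ - a′))  ≡⟨ cong (λ z → (b′ - b) + z) (ℤ.+-inverseʳ (b′ - a′)) ⟩
  (b′ - b) + + 0                      ≡⟨ ℤ.+-identityʳ (b′ - b) ⟩
  b′ - b                              ∎
  where open ≡-Reasoning

a+4≰a : ∀ a → ¬ (a + + 4 ≤ a)
a+4≰a a a+4≤a with +-cancelʳ-≤ a {+ 4} {+ 0} (subst₂ _≤_ (ℤ.+-comm a (+ 4)) (sym (ℤ.+-identityˡ a)) a+4≤a)
... | +≤+ ()

4*z≢0⇒4≤4*z : ∀ z → + 0 ≤ + 4 ℤ.* z → + 4 ℤ.* z ≢ + 0 → + 4 ≤ + 4 ℤ.* z
4*z≢0⇒4≤4*z (+ 0) _ 4z≢0 = ⊥-elim (4z≢0 refl)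
4*z≢0⇒4≤4*z (+ suc n) _ _ = +≤+ (ℕ.m≤m*n 4 (suc n))
4*z≢0⇒4≤4*z -[1+ n ] () _

∣a+4-c∣+4≡∣a-c∣ : ∀ a c → a + + 4 ≤ c → ∣ (a + + 4) - c ∣ ℕ.+ 4 ≡ ∣ a - c ∣
∣a+4-c∣+4≡∣a-c∣ a c a+4≤c with c - (a + + 4) in e | ℤ.i≤j⇒0≤j-i a+4≤c
... | + m | _ = begin
  ∣ (a + + 4) - c ∣ ℕ.+ 4      ≡⟨ cong (λ z → ∣ z ∣ ℕ.+ 4) (neg-diff (a + + 4) c) ⟩
  ∣ - (c - (a + + 4)) ∣ ℕ.+ 4  ≡⟨ cong (λ z → ∣ - z ∣ ℕ.+ 4) e ⟩
  ∣ - + m ∣ ℕ.+ 4              ≡⟨ cong (ℕ._+ 4) (ℤ.∣-i∣≡∣i∣ (+ m)) ⟩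
  m ℕ.+ 4                      ≡⟨ sym (ℤ.∣-i∣≡∣i∣ (+ m + + 4)) ⟩
  ∣ - (+ m + + 4) ∣            ≡⟨ cong (λ z → ∣ - (z + + 4) ∣) (sym e) ⟩
  ∣ - ((c - (a + + 4)) + + 4) ∣ ≡⟨ cong ∣_∣ (solve 2 (λ a c → :- ((c :- (a :+ con (+ 4))) :+ con (+ 4)) := a :- c) refl a c) ⟩
  ∣ a - c ∣                    ∎
  where
    open ≡-Reasoning
    neg-diff : ∀ x y → x - y ≡ - (y - x)
    neg-diff = solve 2 (λ x y → x :- y := :- (y :- x)) refl

module _ {A : Set} where

  sumℤ-mono-≤ : (f g : A → ℤ) {xs : List A} → All (λ x → f x ≤ g x) xs →
                sumℤ (map f xs) ≤ sumℤ (map g xs)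
  sumℤ-mono-≤ f g [] = ℤ.≤-refl
  sumℤ-mono-≤ f g (p ∷ ps) = ℤ.+-mono-≤ p (sumℤ-mono-≤ f g ps)

  sumℤ-cong : (f g : A → ℤ) {xs : List A} → All (λ x → f x ≡ g x) xs →
              sumℤ (map f xs) ≡ sumℤ (map g xs)
  sumℤ-cong f g [] = refl
  sumℤ-cong f g (p ∷ ps) = cong₂ _+_ p (sumℤ-cong f g ps)

  sumℤ-mono-≤-equality : (f g : A → ℤ) {xs : List A} → All (λ x → f x ≤ g x) xs →
                         sumℤ (map f xs) ≡ sumℤ (map g xs) → All (λ x → f x ≡ g x) xs
  sumℤ-mono-≤-equality f g [] _ = []
  sumℤ-mono-≤-equality f g {x ∷ xs} (p ∷ ps) e = fx≡gx ∷ sumℤ-mono-≤-equality f g ps tails≡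
    where
      Sf = sumℤ (map f xs)
      Sg = sumℤ (map g xs)
      gx≤fx : g x ≤ f x
      gx≤fx = +-cancelʳ-≤ Sg (ℤ.≤-trans (ℤ.≤-reflexive (sym e)) (ℤ.+-monoʳ-≤ (f x) (sumℤ-mono-≤ f g ps)))
      fx≡gx : f x ≡ g x
      fx≡gx = ℤ.≤-antisym p gx≤fx
      tails≡ : Sf ≡ Sg
      tails≡ = +-cancelˡ-≡ (f x) _ _ (trans e (cong (_+ Sg) (sym fx≡gx)))

  sum-mono-≤ : (f g : A → ℕ) → (∀ x → f x ℕ.≤ g x) → ∀ xs → sum (map f xs) ℕ.≤ sum (map g xs)
  sum-mono-≤ f g f≤g [] = z≤n
  sum-mono-≤ f g f≤g (x ∷ xs) = ℕ.+-mono-≤ (f≤g x) (sum-mono-≤ f g f≤g xs)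

  sum-mono-< : (f g : A → ℕ) → (∀ x → f x ℕ.≤ g x) → ∀ {x xs} → x ∈ xs → f x ℕ.< g x →
               sum (map f xs) ℕ.< sum (map g xs)
  sum-mono-< f g f≤g {xs = y ∷ xs} (here refl) fx<gx = ℕ.+-mono-<-≤ fx<gx (sum-mono-≤ f g f≤g xs)
  sum-mono-< f g f≤g {xs = y ∷ xs} (there x∈xs) fx<gx = ℕ.+-mono-≤-< (f≤g y) (sum-mono-< f g f≤g x∈xs fx<gx)

count : {A : Set} {P : A → Set} → (∀ x → Dec (P x)) → List A → ℕ
count P? xs = length (filter P? xs)

module _ {A : Set} {P Q : A → Set} (P? : ∀ x → Dec (P x)) (Q? : ∀ x → Dec (Q x)) (P⇒Q : ∀ {x} → P x → Q x) where

  count-mono : ∀ xs → count P? xs ℕ.≤ count Q? xs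
  count-mono [] = z≤n
  count-mono (x ∷ xs) with P? x | Q? x
  ... | yes _ | yes _ = s≤s (count-mono xs)
  ... | yes p | no ¬q = ⊥-elim (¬q (P⇒Q p))
  ... | no _ | yes _ = ℕ.m≤n⇒m≤1+n (count-mono xs)
  ... | no _ | no _ = count-mono xs

  count-mono-< : ∀ {y xs} → y ∈ xs → Q y → ¬ P y → count P? xs ℕ.< count Q? xs
  count-mono-< {xs = x ∷ xs} (here refl) qx ¬px with P? x | Q? x
  ... | yes px | _ = ⊥-elim (¬px px)
  ... | no _ | yes _ = s≤s (count-mono xs)
  ... | no _ | no ¬qx = ⊥-elim (¬qx qx)
  count-mono-< {xs = x ∷ xs} (there y∈xs) qy ¬py with P? x | Q? x
  ... | yes _ | yes _ = s≤s (count-mono-< y∈xs qy ¬py)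
  ... | yes p | no ¬q = ⊥-elim (¬q (P⇒Q p))
  ... | no _ | yes _ = ℕ.m<n⇒m<1+n (count-mono-< y∈xs qy ¬py)
  ... | no _ | no _ = count-mono-< y∈xs qy ¬py

module _ {A : Set} where

  last : A → List A → A
  last a [] = a
  last a (b ∷ bs) = last b bs

  Chain : (A → A → Set) → A → List A → Set
  Chain R a [] = ⊤
  Chain R a (b ∷ bs) = R a b × Chain R b bs

  last-∈ : ∀ a bs → last a bs ∈ a ∷ bs
  last-∈ a [] = here refl
  last-∈ a (b ∷ bs) = there (last-∈ b bs)

  last-snoc : ∀ a bs z → last a (bs ++ [ z ]) ≡ z
  last-snoc a [] z = refl
  last-snoc a (b ∷ bs) z = last-snoc b bs z

  last-++ : ∀ a bs z cs → last a (bs ++ z ∷ cs) ≡ last z cs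
  last-++ a [] z cs = refl
  last-++ a (b ∷ bs) z cs = last-++ b bs z cs

  Unique-last≡head : ∀ a bs → Unique (a ∷ bs) → last a bs ≡ a → bs ≡ []
  Unique-last≡head a [] _ _ = refl
  Unique-last≡head a (b ∷ bs) (a∉bs ∷ _) e = ⊥-elim (All.lookup a∉bs (last-∈ b bs) (sym e))

  Chain-snoc : ∀ {R : A → A → Set} a bs z → Chain R a bs → R (last a bs) z → Chain R a (bs ++ [ z ])
  Chain-snoc a [] z _ r = r , tt
  Chain-snoc a (b ∷ bs) z (r , ch) r′ = r , Chain-snoc b bs z ch r′

  Chain-prefix : ∀ {R : A → A → Set} a bs z cs → Chain R a (bs ++ z ∷ cs) → Chain R a (bs ++ [ z ])
  Chain-prefix a [] z cs (r , _) = r , tt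
  Chain-prefix a (b ∷ bs) z cs (r , ch) = r , Chain-prefix b bs z cs ch

  Chain-suffix : ∀ {R : A → A → Set} a bs z cs → Chain R a (bs ++ z ∷ cs) → Chain R z cs
  Chain-suffix a [] z cs (_ , ch) = ch
  Chain-suffix a (b ∷ bs) z cs (_ , ch) = Chain-suffix b bs z cs ch

  Chain⇒cyc : ∀ {R : A → A → Set} a bs → Chain R a bs → R (last a bs) a → All (uncurry′ R) (cyc (a ∷ bs))
  Chain⇒cyc {R} a bs = go a bs
    where
      go : ∀ b bs → Chain R b bs → R (last b bs) a → All (uncurry′ R) (zip (b ∷ bs) (bs ++ [ a ]))
      go b [] _ r = r ∷ []
      go b (c ∷ cs) (r , ch) r′ = r ∷ go c cs ch r′

  cyc⇒Star : ∀ {R : A → A → Set} a bs → All (uncurry′ R) (cyc (a ∷ bs)) → ∀ {u v} → u ∈ a ∷ bs → v ∈ a ∷ bs → Star R u v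
  cyc⇒Star {R} a bs pairs u∈ v∈ = proj₂ (go a bs pairs u∈) ◅◅ proj₁ (go a bs pairs v∈)
    where
      go : ∀ b bs → All (uncurry′ R) (zip (b ∷ bs) (bs ++ [ a ])) → ∀ {v} → v ∈ b ∷ bs → Star R b v × Star R v a
      go b [] (r ∷ []) (here refl) = ε , r ◅ ε
      go b (c ∷ cs) (r ∷ rs) (here refl) = ε , r ◅ proj₂ (go c cs rs (here refl))
      go b (c ∷ cs) (r ∷ rs) (there v∈) = let b⇝v , v⇝a = go c cs rs v∈ in r ◅ b⇝v , v⇝a

  Unique-snoc : ∀ (bs : List A) z → Unique bs → z ∉ bs → Unique (bs ++ [ z ])
  Unique-snoc [] z _ _ = [] ∷ []
  Unique-snoc (b ∷ bs) z (b∉bs ∷ u) z∉ =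
    All.++⁺ b∉bs ((λ b≡z → z∉ (here (sym b≡z))) ∷ []) ∷ Unique-snoc bs z u (λ z∈ → z∉ (there z∈))

  Unique-prefix : ∀ (bs : List A) z cs → Unique (bs ++ z ∷ cs) → Unique (bs ++ [ z ])
  Unique-prefix [] z cs _ = [] ∷ []
  Unique-prefix (b ∷ bs) z cs (b∉ ∷ u) = prefix b∉ ∷ Unique-prefix bs z cs u
    where
      prefix : ∀ {P : A → Set} → All P (bs ++ z ∷ cs) → All P (bs ++ [ z ])
      prefix ps with All.++⁻ bs ps
      ... | ps₁ , pz ∷ _ = All.++⁺ ps₁ (pz ∷ [])

  Unique-suffix : ∀ (bs : List A) {cs} → Unique (bs ++ cs) → Unique cs
  Unique-suffix [] u = u
  Unique-suffix (b ∷ bs) (_ ∷ u) = Unique-suffix bs u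

module FiniteRelation {A : Set} (_≟_ : DecidableEquality A) (elements : List A) (complete : ∀ x → x ∈ elements)
  {R : A → A → Set} (R? : Decidable R) where

  _∈?_ : (x : A) (xs : List A) → Dec (x ∈ xs)
  _∈?_ = DecMembership._∈?_ _≟_

  Closed : List A → Set
  Closed S = ∀ {y z} → y ∈ S → R y z → z ∈ S

  private
    unvisited : List A → ℕ
    unvisited S = count (λ z → ¬? (z ∈? S)) elements

    Edge-out-of : List A → A → A → Set
    Edge-out-of S y z = R y z × z ∉ S

    edge-out? : ∀ S → Dec (Any (λ y → Any (Edge-out-of S y) elements) S)
    edge-out? S = any? (λ y → any? (λ z → R? y z ×-dec ¬? (z ∈? S)) elements) S

    no-edge-out⇒Closed : ∀ S → ¬ Any (λ y → Any (Edge-out-of S y) elements) S → Closed S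
    no-edge-out⇒Closed S none {y} {z} y∈S yRz with z ∈? S
    ... | yes z∈S = z∈S
    ... | no z∉S = ⊥-elim (none (lose y∈S (lose (complete z) (yRz , z∉S))))

    closure : ∀ x S → Acc ℕ._<_ (unvisited S) → All (Star R x) S →
              Σ (List A) λ S' → (∀ {v} → v ∈ S → v ∈ S') × Closed S' × All (Star R x) S'
    closure x S (acc smaller) reached with edge-out? S
    ... | no none = S , (λ v∈S → v∈S) , no-edge-out⇒Closed S none , reached
    ... | yes some with find some
    ...   | y , y∈S , out with find out
    ...     | z , _ , (yRz , z∉S) =
      let S' , S⊆S' , closed , reached' = closure x (z ∷ S) (smaller fewer) (x⇝z ∷ reached)
      in S' , (λ v∈S → S⊆S' (there v∈S)) , closed , reached'
      where
        x⇝z : Star R x z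
        x⇝z = All.lookup reached y∈S ◅◅ (yRz ◅ ε)
        fewer : unvisited (z ∷ S) ℕ.< unvisited S
        fewer = count-mono-< (λ v → ¬? (v ∈? (z ∷ S))) (λ v → ¬? (v ∈? S)) (λ v∉zS v∈S → v∉zS (there v∈S))
                  (complete z) z∉S (λ z∉zS → z∉zS (here refl))

  Closed-star : ∀ {S y z} → Closed S → y ∈ S → Star R y z → z ∈ S
  Closed-star closed y∈S ε = y∈S
  Closed-star closed y∈S (yRw ◅ w⇝z) = Closed-star closed (closed y∈S yRw) w⇝z

  star? : Decidable (Star R)
  star? x y with closure x [ x ] (<-wellFounded _) (ε ∷ [])
  ... | S , x∈S , closed , reached with y ∈? S
  ...   | yes y∈S = yes (All.lookup reached y∈S)
  ...   | no y∉S = no λ x⇝y → y∉S (Closed-star closed (x∈S (here refl)) x⇝y)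

  minimal-below : ∀ u → Σ A λ s → Star R s u × (∀ v → Star R v s → Star R s v)
  minimal-below u = go u (<-wellFounded _)
    where
      predecessors : A → ℕ
      predecessors u = count (λ w → star? w u) elements

      go : ∀ u → Acc ℕ._<_ (predecessors u) → Σ A λ s → Star R s u × (∀ v → Star R v s → Star R s v)
      go u (acc smaller) with any? (λ v → star? v u ×-dec ¬? (star? u v)) elements
      ... | yes below with find below
      ...   | v , _ , (v⇝u , u⇝̸v) =
        let s , s⇝v , minimal = go v (smaller (count-mono-< (λ w → star? w v) (λ w → star? w u)
                                  (_◅◅ v⇝u) (complete u) ε u⇝̸v))
        in s , s⇝v ◅◅ v⇝u , minimal
      go u (acc smaller) | no none = u , ε , minimal
        where
          minimal : ∀ v → Star R v u → Star R u v
          minimal v v⇝u with star? u v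
          ... | yes u⇝v = u⇝v
          ... | no u⇝̸v = ⊥-elim (none (lose (complete v) (v⇝u , u⇝̸v)))

-- A closed R-walk is shortened, one simple cycle at a time, to a simple path; each removed
-- cycle lies in one E-class, so the walk's start stays E-related to every vertex it visits.
module StronglyConnected {A : Set} (_≟_ : DecidableEquality A) (R E : A → A → Set) (E-equiv : IsEquivalence E)
  (simple-cycle : ∀ a bs → Chain R a bs → R (last a bs) a → Unique (a ∷ bs) → All (E a) bs) where

  open IsEquivalence E-equiv renaming (refl to E-refl; sym to E-sym; trans to E-trans)

  private
    _∈?_ : (x : A) (xs : List A) → Dec (x ∈ xs)
    _∈?_ = DecMembership._∈?_ _≟_

    simple-cycle-∈ : ∀ a bs → Chain R a bs → R (last a bs) a → Unique (a ∷ bs) → ∀ {v} → v ∈ a ∷ bs → E a v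
    simple-cycle-∈ a bs ch r u (here refl) = E-refl
    simple-cycle-∈ a bs ch r u (there v∈) = All.lookup (simple-cycle a bs ch r u) v∈

    module Shorten (x : A) (Q : A → Set) (Q-resp : ∀ {v w} → Q v → E v w → Q w) where

      SimplePath : List A → Set
      SimplePath ps = Chain R x ps × Unique (x ∷ ps) × Any Q (x ∷ ps)

      Q-on-cycle : ∀ {a bs} → (∀ {v} → v ∈ bs → E a v) → Any Q bs → Q a
      Q-on-cycle a~ (here qv) = Q-resp qv (E-sym (a~ (here refl)))
      Q-on-cycle a~ (there q) = Q-on-cycle (λ v∈ → a~ (there v∈)) q

      extend : ∀ ps {z} → SimplePath ps → R (last x ps) z → Σ (List A) λ ps′ → SimplePath ps′ × last x ps′ ≡ z
      extend ps {z} (ch , u , q) r with z ∈? (x ∷ ps)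
      ... | no z∉ = ps ++ [ z ] , (Chain-snoc x ps z ch r , Unique-snoc (x ∷ ps) z u z∉ , Any.++⁺ˡ q) , last-snoc x ps z
      ... | yes (here refl) = [] , (tt , [] ∷ [] , here (Q-on-cycle (simple-cycle-∈ x ps ch r u) q)) , refl
      ... | yes (there z∈) with ∈-∃++ z∈
      ...   | bs , cs , refl = bs ++ [ z ] , (Chain-prefix x bs z cs ch , Unique-prefix (x ∷ bs) z cs u , q′) , last-snoc x bs z
        where
          z~ : ∀ {v} → v ∈ z ∷ cs → E z v
          z~ = simple-cycle-∈ z cs (Chain-suffix x bs z cs ch) (subst (λ w → R w z) (last-++ x bs z cs) r)
                 (Unique-suffix (x ∷ bs) u)
          q′ : Any Q (x ∷ bs ++ [ z ])
          q′ with Any.++⁻ (x ∷ bs) q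
          ... | inj₁ q-bs = Any.++⁺ˡ q-bs
          ... | inj₂ q-cs = Any.++⁺ʳ (x ∷ bs) (here (Q-on-cycle z~ q-cs))

      follow : ∀ ps {z} → SimplePath ps → Star R (last x ps) z → Σ (List A) λ ps′ → SimplePath ps′ × last x ps′ ≡ z
      follow ps sp ε = ps , sp , refl
      follow ps sp (r ◅ rs) with extend ps sp r
      ... | ps′ , sp′ , refl = follow ps′ sp′ rs

  mutually-reachable⇒E : ∀ {x y} → Star R x y → Star R y x → E x y
  mutually-reachable⇒E {x} {y} x⇝y y⇝x = E-sym (back-to-x (to-y x⇝y))
    where
      module Trivial = Shorten x (λ _ → ⊤) (λ _ _ → tt)
      module Via-y = Shorten x (E y) E-trans

      to-y : Star R x y → Σ (List A) λ ps → Via-y.SimplePath ps × last x ps ≡ y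
      to-y x⇝y with Trivial.follow [] (tt , [] ∷ [] , here tt) x⇝y
      ... | ps , (ch , u , _) , refl = ps , (ch , u , lose (last-∈ x ps) E-refl) , refl

      back-to-x : Σ (List A) (λ ps → Via-y.SimplePath ps × last x ps ≡ y) → E y x
      back-to-x (ps , sp , refl) with Via-y.follow ps sp y⇝x
      ... | ps′ , (_ , u′ , q) , last≡x with Unique-last≡head x ps′ u′ last≡x
      ...   | refl with q
      ...     | here y~x = y~x

==ℤ-true : ∀ {x y} → x ≡ y → (x ==ℤ y) ≡ true
==ℤ-true {x} {y} x≡y with x ℤ.≟ y
... | yes _ = refl
... | no x≢y = ⊥-elim (x≢y x≡y)

==ℤ-false : ∀ {x y} → x ≢ y → (x ==ℤ y) ≡ false
==ℤ-false {x} {y} x≢y with x ℤ.≟ y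
... | yes x≡y = ⊥-elim (x≢y x≡y)
... | no _ = refl

leftCell-east : ∀ x y → leftCell (x , y) (x + + 1 , y) ≡ (x , y)
leftCell-east x y rewrite ==ℤ-true {x + + 1} refl = refl

leftCell-north : ∀ x y → leftCell (x , y) (x , y + + 1) ≡ (x - + 1 , y)
leftCell-north x y
  rewrite ==ℤ-false (x≢x+1 x) | ==ℤ-false (x≢x-1 x) | ==ℤ-true {y + + 1} refl = refl

leftCell-west : ∀ x y → leftCell (x + + 1 , y) (x , y) ≡ (x , y - + 1)
leftCell-west x y
  rewrite ==ℤ-false (x≢x+1+1 x) | ==ℤ-true (sym (+1-1 x)) = cong (_, y - + 1) (+1-1 x)

leftCell-south : ∀ x y → leftCell (x , y + + 1) (x , y) ≡ (x , y)
leftCell-south x y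
  rewrite ==ℤ-false (x≢x+1 x) | ==ℤ-false (x≢x-1 x) | ==ℤ-false (x≢x+1+1 y) = cong (x ,_) (+1-1 y)

isEven : ℕ → Bool
isEven m = (m ℕ.% 2) ℕ.≡ᵇ 0

isEven-suc : ∀ m → isEven (suc m) ≡ not (isEven m)
isEven-suc zero = refl
isEven-suc (suc zero) = refl
isEven-suc (suc (suc m)) = isEven-suc m

isBlack-step : ∀ a b a′ b′ → a′ + b′ ≡ (a + b) + + 1 → isBlack (a′ , b′) ≡ not (isBlack (a , b))
isBlack-step a b a′ b′ e = trans (cong (λ z → isEven ∣ z ∣) e) (parity-suc (a + b))
  where
    parity-suc : ∀ z → isEven ∣ z + + 1 ∣ ≡ not (isEven ∣ z ∣)
    parity-suc (+ n) rewrite ℕ.+-comm n 1 = isEven-suc n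
    parity-suc -[1+ zero ] = refl
    parity-suc -[1+ suc n ] = trans (sym (not-involutive _)) (cong not (sym (isEven-suc (suc n))))

isBlack-step⁻ : ∀ a b a′ b′ → a + b ≡ (a′ + b′) + + 1 → isBlack (a′ , b′) ≡ not (isBlack (a , b))
isBlack-step⁻ a b a′ b′ e = trans (sym (not-involutive _)) (cong not (sym (isBlack-step a′ b′ a b e)))

inner-cell : ∀ c k → leftCell (corner c (nextC k)) (corner c k) ≡ c
inner-cell (i , j) LL = leftCell-south i j
inner-cell (i , j) UL = trans (leftCell-west i (j + + 1)) (cong (i ,_) (+1-1 j))
inner-cell (i , j) UR = trans (leftCell-north (i + + 1) j) (cong (_, j) (+1-1 i))
inner-cell (i , j) LR = leftCell-east i j

outer-cell-colour : ∀ c k → isBlack (leftCell (corner c k) (corner c (nextC k))) ≡ not (isBlack c)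
outer-cell-colour (i , j) LL rewrite leftCell-north i j =
  isBlack-step⁻ i j (i - + 1) j (solve 2 (λ i j → i :+ j := ((i :- con (+ 1)) :+ j) :+ con (+ 1)) refl i j)
outer-cell-colour (i , j) UL rewrite leftCell-east i (j + + 1) =
  isBlack-step i j i (j + + 1) (sym (ℤ.+-assoc i j (+ 1)))
outer-cell-colour (i , j) UR rewrite leftCell-south (i + + 1) j =
  isBlack-step i j (i + + 1) j (solve 2 (λ i j → (i :+ con (+ 1)) :+ j := (i :+ j) :+ con (+ 1)) refl i j)
outer-cell-colour (i , j) LR rewrite leftCell-west i j =
  isBlack-step⁻ i j i (j - + 1) (solve 2 (λ i j → i :+ j := (i :+ (j :- con (+ 1))) :+ con (+ 1)) refl i j)

spP-antisym : ∀ c k → spP (corner c (nextC k)) (corner c k) ≡ - spP (corner c k) (corner c (nextC k))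
spP-antisym c k rewrite inner-cell c k | outer-cell-colour c k with isBlack c
... | true = refl
... | false = refl

quadℕ-injective : ∀ q q′ → quadℕ q ≡ quadℕ q′ → q ≡ q′
quadℕ-injective NE NE _ = refl
quadℕ-injective NW NW _ = refl
quadℕ-injective SW SW _ = refl
quadℕ-injective SE SE _ = refl

_≟q_ : DecidableEquality Quad
q ≟q q′ = map′ (quadℕ-injective q q′) (cong quadℕ) (quadℕ q ℕ.≟ quadℕ q′)

==q⇒≡ : ∀ q q′ → T (q ==q q′) → q ≡ q′
==q⇒≡ q q′ t = quadℕ-injective q q′ (ℕ.≡ᵇ⇒≡ (quadℕ q) (quadℕ q′) t)

==q-refl : ∀ q → T (q ==q q)
==q-refl q = ℕ.≡⇒≡ᵇ (quadℕ q) (quadℕ q) refl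

cornerOf : Quad → Corner
cornerOf NE = LL
cornerOf SE = UL
cornerOf SW = UR
cornerOf NW = LR

quadOf-cornerOf : ∀ q → quadOf (cornerOf q) ≡ q
quadOf-cornerOf NE = refl
quadOf-cornerOf NW = refl
quadOf-cornerOf SW = refl
quadOf-cornerOf SE = refl

cellAt-corner : ∀ c k → cellAt (corner c k) (quadOf k) ≡ c
cellAt-corner (i , j) LL = refl
cellAt-corner (i , j) UL = cong (i ,_) (+1-1 j)
cellAt-corner (i , j) UR = cong₂ _,_ (+1-1 i) (+1-1 j)
cellAt-corner (i , j) LR = cong (_, j) (+1-1 i)

corner-cellAt : ∀ p q → corner (cellAt p q) (cornerOf q) ≡ p
corner-cellAt (x , y) NE = refl
corner-cellAt (x , y) NW = cong (_, y) (-1+1 x)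
corner-cellAt (x , y) SW = cong₂ _,_ (-1+1 x) (-1+1 y)
corner-cellAt (x , y) SE = cong (x ,_) (-1+1 y)

==ᶜ⇒≡ : ∀ c c′ → T (c ==ᶜ c′) → c ≡ c′
==ᶜ⇒≡ (i , j) (i′ , j′) t with Equivalence.to (T-∧ {i ==ℤ i′} {j ==ℤ j′}) t
... | ti , tj = cong₂ _,_ (toWitness {a? = i ℤ.≟ i′} ti) (toWitness {a? = j ℤ.≟ j′} tj)

inF⇒∈ : ∀ cs c → T (inF cs c) → c ∈ cs
inF⇒∈ (c′ ∷ cs) c t with Equivalence.to T-∨ t
... | inj₁ c′==c = here (sym (==ᶜ⇒≡ c′ c c′==c))
... | inj₂ t′ = there (inF⇒∈ cs c t′)

data Neighbour : Cell → Cell → Set where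
  below : ∀ {i j} → Neighbour (i , j) (i , j - + 1)
  above : ∀ {i j} → Neighbour (i , j) (i , j + + 1)
  left  : ∀ {i j} → Neighbour (i , j) (i - + 1 , j)
  right : ∀ {i j} → Neighbour (i , j) (i + + 1 , j)

Adj4⇒Neighbour : ∀ c c′ → Adj4 c c′ → Neighbour c c′
Adj4⇒Neighbour (i , j) (i′ , j′) adj with ∣ i - i′ ∣ in di | ∣ j - j′ ∣ in dj
Adj4⇒Neighbour (i , j) (i′ , j′) refl | 0 | 1
  with sym (ℤ.i-j≡0⇒i≡j i i′ (ℤ.∣i∣≡0⇒i≡0 di)) | abs≡1 (j - j′) dj
... | refl | inj₁ j-j′≡1 rewrite solve-for j j′ j-j′≡1 = below
... | refl | inj₂ j-j′≡-1 rewrite solve-for j j′ j-j′≡-1 = above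
Adj4⇒Neighbour (i , j) (i′ , j′) refl | 1 | 0
  with sym (ℤ.i-j≡0⇒i≡j j j′ (ℤ.∣i∣≡0⇒i≡0 dj)) | abs≡1 (i - i′) di
... | refl | inj₁ i-i′≡1 rewrite solve-for i i′ i-i′≡1 = left
... | refl | inj₂ i-i′≡-1 rewrite solve-for i i′ i-i′≡-1 = right

module FigureGraph (F : Figure) where

  private
    cs : List Cell
    cs = cells F

  V-≡ : (v w : V F) → proj₁ v ≡ proj₁ w → v ≡ w
  V-≡ (x , p) (.x , q) refl = cong (x ,_) (T-irrelevant p q)

  _≟ᵥ_ : DecidableEquality (V F)
  v ≟ᵥ w = map′ (V-≡ v w) (cong proj₁) (≡-dec (≡-dec ℤ._≟_ ℤ._≟_) _≟q_ (proj₁ v) (proj₁ w))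

  private
    minQuad-∈F : ∀ p q → T (inF cs (cellAt p q)) → T (inF cs (cellAt p (minQuad cs p)))
    minQuad-∈F p q t with inF cs (cellAt p NE) in e₁
    ... | true = subst T (sym e₁) tt
    ... | false with inF cs (cellAt p NW) in e₂
    ...   | true = subst T (sym e₂) tt
    ...   | false with inF cs (cellAt p SW) in e₃
    ...     | true = subst T (sym e₃) tt
    ...     | false with q
    ...       | NE = ⊥-elim (subst T e₁ t)
    ...       | NW = ⊥-elim (subst T e₂ t)
    ...       | SW = ⊥-elim (subst T e₃ t)
    ...       | SE = t

    isVertex-corner : ∀ p k → T (inF cs (cellAt p (quadOf k))) →
      T (isVertex cs (p , (if pinch cs p then quadOf k else minQuad cs p)))
    isVertex-corner p k t with pinch cs p
    ... | true = Equivalence.from T-∧ (t , tt)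
    ... | false = Equivalence.from T-∧ (minQuad-∈F p (quadOf k) t , ==q-refl (minQuad cs p))

    name-of-vertex : ∀ p q → T (pinch cs p ∨ (q ==q minQuad cs p)) →
      (p , (if pinch cs p then quadOf (cornerOf q) else minQuad cs p)) ≡ (p , q)
    name-of-vertex p q t with pinch cs p
    ... | true = cong (p ,_) (quadOf-cornerOf q)
    ... | false = cong (p ,_) (sym (==q⇒≡ q (minQuad cs p) t))

  vertex : (c : Cell) → T (inF cs c) → Corner → V F
  vertex c c∈F k = vtxRaw cs c k , isVertex-corner (corner c k) k (subst (T ∘ inF cs) (sym (cellAt-corner c k)) c∈F)

  vertex-surjective : ∀ v → Σ Cell λ c → Σ (T (inF cs c)) λ c∈F → Σ Corner λ k → vertex c c∈F k ≡ v
  vertex-surjective ((p , q) , v∈V) with Equivalence.to T-∧ v∈V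
  ... | c∈F , pinch∨min = cellAt p q , c∈F , cornerOf q , V-≡ _ _ (trans named (name-of-vertex p q pinch∨min))
    where
      named : vtxRaw cs (cellAt p q) (cornerOf q) ≡ (p , (if pinch cs p then quadOf (cornerOf q) else minQuad cs p))
      named rewrite corner-cellAt p q = refl

  corners : List Corner
  corners = LL ∷ UL ∷ UR ∷ LR ∷ []

  ∈-corners : ∀ k → k ∈ corners
  ∈-corners LL = here refl
  ∈-corners UL = there (here refl)
  ∈-corners UR = there (there (here refl))
  ∈-corners LR = there (there (there (here refl)))

  verticesOf : Cell → List (V F)
  verticesOf c with T? (inF cs c)
  ... | yes c∈F = map (vertex c c∈F) corners
  ... | no _ = []

  vertices : List (V F)
  vertices = concatMap verticesOf cs

  ∈-vertices : ∀ v → v ∈ vertices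
  ∈-vertices v with vertex-surjective v
  ... | c , c∈F , k , refl = ∈-concatMap⁺ verticesOf (lose (inF⇒∈ cs c c∈F) (∈-verticesOf c c∈F k))
    where
      ∈-verticesOf : ∀ c c∈F k → vertex c c∈F k ∈ verticesOf c
      ∈-verticesOf c c∈F k with T? (inF cs c)
      ... | yes c∈F′ = subst (_∈ _) (V-≡ _ _ refl) (∈-map⁺ (vertex c c∈F′) (∈-corners k))
      ... | no c∉F = ⊥-elim (c∉F c∈F)

  private
    decPQ : DecidableEquality (Point × Quad)
    decPQ = ≡-dec (≡-dec ℤ._≟_ ℤ._≟_) _≟q_

    Σ-Corner? : {P : Corner → Set} → (∀ k → Dec (P k)) → Dec (Σ Corner P)
    Σ-Corner? P? = map′ satisfied (λ (k , p) → lose (∈-corners k) p) (any? P? corners)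

  arc? : Decidable (Arc F)
  arc? v w = map′ satisfied (λ (c , c∈F , side) → lose (inF⇒∈ cs c c∈F) (c∈F , side))
    (any? (λ c → T? (inF cs c) ×-dec Σ-Corner? (λ k →
       (decPQ (proj₁ v) (vtxRaw cs c k) ×-dec decPQ (proj₁ w) (vtxRaw cs c (nextC k))) ⊎-dec
       (decPQ (proj₁ v) (vtxRaw cs c (nextC k)) ×-dec decPQ (proj₁ w) (vtxRaw cs c k)))) cs)

  Arc-sym : ∀ v w → Arc F v w → Arc F w v
  Arc-sym _ _ (c , c∈F , k , inj₁ (v≡ , w≡)) = c , c∈F , k , inj₂ (w≡ , v≡)
  Arc-sym _ _ (c , c∈F , k , inj₂ (v≡ , w≡)) = c , c∈F , k , inj₁ (w≡ , v≡)

  sp-antisym : ∀ v w → Arc F v w → sp F w v ≡ - sp F v w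
  sp-antisym v w (c , _ , k , inj₁ (v≡ , w≡)) rewrite cong proj₁ v≡ | cong proj₁ w≡ = spP-antisym c k
  sp-antisym v w (c , _ , k , inj₂ (v≡ , w≡)) rewrite cong proj₁ v≡ | cong proj₁ w≡ =
    trans (sym (ℤ.neg-involutive _)) (cong -_ (sym (spP-antisym c k)))

  private
    side : ∀ c c∈F k → Star (Arc F) (vertex c c∈F k) (vertex c c∈F (nextC k))
    side c c∈F k = (c , c∈F , k , inj₁ (refl , refl)) ◅ ε

    from-LL : ∀ c c∈F k → Star (Arc F) (vertex c c∈F LL) (vertex c c∈F k)
    from-LL c c∈F LL = ε
    from-LL c c∈F UL = side c c∈F LL
    from-LL c c∈F UR = side c c∈F LL ◅◅ side c c∈F UL
    from-LL c c∈F LR = side c c∈F LL ◅◅ side c c∈F UL ◅◅ side c c∈F UR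

    around : ∀ c c∈F k k′ → Star (Arc F) (vertex c c∈F k) (vertex c c∈F k′)
    around c c∈F k k′ = reverse (λ {v} {w} → Arc-sym v w) (from-LL c c∈F k) ◅◅ from-LL c c∈F k′

    same-vertex : ∀ c c′ k k′ → corner c′ k′ ≡ corner c k → pinch cs (corner c k) ≡ false →
                  vtxRaw cs c k ≡ vtxRaw cs c′ k′
    same-vertex c c′ k k′ e no-pinch rewrite e | no-pinch = refl

    ∈F-cong : ∀ {c c′} → c ≡ c′ → T (inF cs c) → T (inF cs c′)
    ∈F-cong = subst (T ∘ inF cs)

    NE-SE-not-pinch : ∀ p → T (inF cs (cellAt p NE)) → T (inF cs (cellAt p SE)) → pinch cs p ≡ false
    NE-SE-not-pinch p ne se rewrite Equivalence.to T-≡ ne | Equivalence.to T-≡ se = refl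

    NE-NW-not-pinch : ∀ p → T (inF cs (cellAt p NE)) → T (inF cs (cellAt p NW)) → pinch cs p ≡ false
    NE-NW-not-pinch p ne nw rewrite Equivalence.to T-≡ ne | Equivalence.to T-≡ nw = ∧-zeroʳ _

    shared-vertex : ∀ {c c′} → Neighbour c c′ → ∀ c∈F c′∈F →
                    Σ Corner λ k → Σ Corner λ k′ → vertex c c∈F k ≡ vertex c′ c′∈F k′
    shared-vertex {i , j} below c∈F c′∈F = LL , UL , V-≡ _ _
      (same-vertex (i , j) (i , j - + 1) LL UL (cong (i ,_) (-1+1 j)) (NE-SE-not-pinch (i , j) c∈F c′∈F))
    shared-vertex {i , j} above c∈F c′∈F = UL , LL , V-≡ _ _
      (same-vertex (i , j) (i , j + + 1) UL LL refl (NE-SE-not-pinch (i , j + + 1) c′∈F (∈F-cong (cong (i ,_) (sym (+1-1 j))) c∈F)))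
    shared-vertex {i , j} left c∈F c′∈F = LL , LR , V-≡ _ _
      (same-vertex (i , j) (i - + 1 , j) LL LR (cong (_, j) (-1+1 i)) (NE-NW-not-pinch (i , j) c∈F c′∈F))
    shared-vertex {i , j} right c∈F c′∈F = LR , LL , V-≡ _ _
      (same-vertex (i , j) (i + + 1 , j) LR LL refl (NE-NW-not-pinch (i + + 1 , j) c′∈F (∈F-cong (cong (_, j) (sym (+1-1 i))) c∈F)))

    cells-connected : ∀ {c c′} → Star (Step4 cs) c c′ → ∀ c∈F c′∈F k k′ →
                      Star (Arc F) (vertex c c∈F k) (vertex c′ c′∈F k′)
    cells-connected {c} ε c∈F c∈F′ k k′ rewrite T-irrelevant c∈F c∈F′ = around c c∈F′ k k′
    cells-connected {c} (_◅_ {j = d} (d∈F , adj) rest) c∈F c′∈F k k′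
      with shared-vertex (Adj4⇒Neighbour c d adj) c∈F d∈F
    ... | k₁ , k₂ , e = around c c∈F k k₁ ◅◅ subst (Star (Arc F) _) e ε ◅◅ cells-connected rest d∈F c′∈F k₂ k′

  Arc-connected : ∀ v w → Star (Arc F) v w
  Arc-connected v w with vertex-surjective v | vertex-surjective w
  ... | c , c∈F , k , refl | c′ , c′∈F , k′ , refl = cells-connected (Figure.connected F c c′ c∈F c′∈F) c∈F c′∈F k k′

raise-if : {P : Set} → Dec P → ℤ → ℤ
raise-if (yes _) z = z + + 4
raise-if (no _) z = z

raise-if-yes : {P : Set} (d : Dec P) {z : ℤ} → P → raise-if d z ≡ z + + 4
raise-if-yes (yes _) _ = refl
raise-if-yes (no ¬p) p = ⊥-elim (¬p p)

raise-if-no : {P : Set} (d : Dec P) {z : ℤ} → ¬ P → raise-if d z ≡ z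
raise-if-no (yes p) ¬p = ⊥-elim (¬p p)
raise-if-no (no _) _ = refl

raise-if-≥ : {P : Set} (d : Dec P) {z : ℤ} → z ≤ raise-if d z
raise-if-≥ (yes _) {z} = ℤ.i≤i+j z (+ 4)
raise-if-≥ (no _) = ℤ.≤-refl

module Heights (F : Figure) (eq : V F → V F → ℤ) (eq-antisym : ∀ v w → Arc F v w → eq w v ≡ - eq v w)
  (w0 : V F) where

  open FigureGraph F

  private
    t b : V F → V F → ℤ
    t = tA F eq
    b = bA F eq

  Height : (V F → ℤ) → Set
  Height = IsHeight F eq w0

  t≡b⊎t≡b+4 : ∀ v w → t v w ≡ b v w ⊎ t v w ≡ b v w + + 4
  t≡b⊎t≡b+4 v w = cases (isBoundary F v w) (eq v w) (sp F v w)
    where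
      cases : ∀ bd e s → (if bd then e + s else (e - s) + + 2) ≡ (if bd then e + s else (e - s) - + 2)
                       ⊎ (if bd then e + s else (e - s) + + 2) ≡ (if bd then e + s else (e - s) - + 2) + + 4
      cases true e s = inj₁ refl
      cases false e s = inj₂ (solve 2 (λ e s → (e :- s) :+ con (+ 2) := ((e :- s) :- con (+ 2)) :+ con (+ 4)) refl e s)

  t-antisym : ∀ v w → Arc F v w → t w v ≡ - b v w
  t-antisym v w vw = subst (λ bd → (if bd then eq w v + sp F w v else (eq w v - sp F w v) + + 2) ≡ - b v w)
    (xor-comm (inF (cells F) (leftCell (pt {F} v) (pt {F} w))) (inF (cells F) (leftCell (pt {F} w) (pt {F} v))))
    (negated (isBoundary F v w) (eq-antisym v w vw) (sp-antisym v w vw))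
    where
      negated : ∀ bd {e s e′ s′} → e′ ≡ - e → s′ ≡ - s →
                (if bd then e′ + s′ else (e′ - s′) + + 2) ≡ - (if bd then e + s else (e - s) - + 2)
      negated true {e} {s} refl refl = sym (ℤ.neg-distrib-+ e s)
      negated false {e} {s} refl refl = solve 2 (λ e s → ((:- e) :- (:- s)) :+ con (+ 2) := :- ((e :- s) :- con (+ 2))) refl e s

  b-antisym : ∀ v w → Arc F v w → b v w ≡ - t w v
  b-antisym v w vw = trans (sym (ℤ.neg-involutive _)) (cong -_ (sym (t-antisym v w vw)))

  b≤t : ∀ v w → b v w ≤ t v w
  b≤t v w with t≡b⊎t≡b+4 v w
  ... | inj₁ t≡b = ℤ.≤-reflexive (sym t≡b)
  ... | inj₂ t≡b+4 = subst (b v w ≤_) (sym t≡b+4) (ℤ.i≤i+j (b v w) (+ 4))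

  D-antisym : ∀ (h : V F → ℤ) v w → D {F} h w v ≡ - D {F} h v w
  D-antisym h v w = solve 2 (λ x y → x :- y := :- (y :- x)) refl (h v) (h w)

  D≤t : ∀ {h} → Height h → ∀ {v w} → Arc F v w → D {F} h v w ≤ t v w
  D≤t (_ , steps) {v} {w} vw with steps v w vw
  ... | inj₁ D≡b = subst (_≤ t v w) (sym D≡b) (b≤t v w)
  ... | inj₂ D≡t = ℤ.≤-reflexive D≡t

  Tight : (V F → ℤ) → V F → V F → Set
  Tight h v w = Arc F v w × D {F} h v w ≡ t v w

  bottom⇒reverse-tight : ∀ h {v w} → Arc F v w → D {F} h v w ≡ b v w → D {F} h w v ≡ t w v
  bottom⇒reverse-tight h {v} {w} vw D≡b = trans (D-antisym h v w) (trans (cong -_ D≡b) (sym (t-antisym v w vw)))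

  reverse-tight⇒bottom : ∀ h {v w} → Arc F v w → D {F} h w v ≡ t w v → D {F} h v w ≡ b v w
  reverse-tight⇒bottom h {v} {w} vw D≡t =
    trans (D-antisym h w v) (trans (cong -_ D≡t) (sym (b-antisym v w vw)))

  tight? : ∀ h → Decidable (Tight h)
  tight? h v w = arc? v w ×-dec (D {F} h v w ℤ.≟ t v w)

  module TightReach (h : V F → ℤ) = FiniteRelation _≟ᵥ_ vertices ∈-vertices (tight? h)

  sumArcs-D : ∀ h C → sumArcs (D {F} h) C ≡ + 0
  sumArcs-D h [] = refl
  sumArcs-D h (x ∷ xs) = trans (telescope x xs) (ℤ.+-inverseʳ (h x))
    where
      telescope : ∀ a bs → sumℤ (map (λ e → D {F} h (proj₁ e) (proj₂ e)) (zip (a ∷ bs) (bs ++ [ x ]))) ≡ h x - h a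
      telescope a [] = ℤ.+-identityʳ (h x - h a)
      telescope a (c ∷ cs) = trans (cong (λ z → D {F} h a c + z) (telescope c cs)) (trans (ℤ.+-comm (h c - h a) (h x - h c)) (ℤ.+-minus-telescope (h x) (h c) (h a)))

  Critical⇒Tight : ∀ {h} → Height h → ∀ {C} → Critical F eq C → All (uncurry′ (Tight h)) (cyc C)
  Critical⇒Tight {h} H {C} ((_ , _ , arcs) , Σt≡0) = All.zip (arcs , all-tight)
    where
      Dₑ tₑ : V F × V F → ℤ
      Dₑ (v , w) = D {F} h v w
      tₑ (v , w) = t v w
      all-tight : All (λ e → Dₑ e ≡ tₑ e) (cyc C)
      all-tight = sumℤ-mono-≤-equality Dₑ tₑ (All.map (D≤t {h} H) arcs) (trans (sumArcs-D h C) (sym Σt≡0))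

  CritEquiv-sym : ∀ {v w} → CritEquiv F eq v w → CritEquiv F eq w v
  CritEquiv-sym = reverse (λ (C , crit , v∈ , w∈) → C , crit , w∈ , v∈)

  CritEquiv-isEquivalence : IsEquivalence (CritEquiv F eq)
  CritEquiv-isEquivalence = record { refl = ε ; sym = CritEquiv-sym ; trans = _◅◅_ }

  CritEquiv⇒Star-Tight : ∀ {h} → Height h → ∀ {v w} → CritEquiv F eq v w → Star (Tight h) v w
  CritEquiv⇒Star-Tight H ε = ε
  CritEquiv⇒Star-Tight {h} H ((x ∷ xs , crit , v∈ , w∈) ◅ rest) =
    cyc⇒Star x xs (Critical⇒Tight {h} H crit) v∈ w∈ ◅◅ CritEquiv⇒Star-Tight {h} H rest

  simple-tight-cycle⇒CritEquiv : ∀ {h} a bs → Chain (Tight h) a bs → Tight h (last a bs) a → Unique (a ∷ bs) →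
                                 All (CritEquiv F eq a) bs
  simple-tight-cycle⇒CritEquiv a [] _ _ _ = []
  simple-tight-cycle⇒CritEquiv {h} a bs@(_ ∷ _) ch closing u =
    All.tabulate λ v∈ → (a ∷ bs , critical , here refl , there v∈) ◅ ε
    where
      tights : All (uncurry′ (Tight h)) (cyc (a ∷ bs))
      tights = Chain⇒cyc a bs ch closing
      critical : Critical F eq (a ∷ bs)
      critical = (s≤s (s≤s z≤n) , u , All.map proj₁ tights) ,
                 trans (sym (sumℤ-cong (λ (v , w) → D {F} h v w) (λ (v , w) → t v w) (All.map proj₂ tights)))
                       (sumArcs-D h (a ∷ bs))

  Star-Tight⇒CritEquiv : ∀ {h v w} → Star (Tight h) v w → Star (Tight h) w v → CritEquiv F eq v w
  Star-Tight⇒CritEquiv {h} = StronglyConnected.mutually-reachable⇒E _≟ᵥ_ (Tight h) (CritEquiv F eq)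
    CritEquiv-isEquivalence (simple-tight-cycle⇒CritEquiv {h})

  opaque
    CritEquiv? : ∀ {h} → Height h → Decidable (CritEquiv F eq)
    CritEquiv? {h} H v w = map′ (λ (v⇝w , w⇝v) → Star-Tight⇒CritEquiv {h} v⇝w w⇝v)
      (λ v~w → CritEquiv⇒Star-Tight {h} H v~w , CritEquiv⇒Star-Tight {h} H (CritEquiv-sym v~w))
      (TightReach.star? h v w ×-dec TightReach.star? h w v)

  gap : (V F → ℤ) → (V F → ℤ) → V F → ℤ
  gap h h′ v = h′ v - h v

  gap-w0 : ∀ {h h′} → Height h → Height h′ → gap h h′ w0 ≡ + 0
  gap-w0 H H′ = cong₂ _-_ (proj₁ H′) (proj₁ H)

  gap-antitone : ∀ {h h′} → Height h′ → ∀ {v w} → Star (Tight h) v w → gap h h′ w ≤ gap h h′ v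
  gap-antitone H′ ε = ℤ.≤-refl
  gap-antitone {h} {h′} H′ {v} (_◅_ {j = y} (vy , D≡t) rest) = ℤ.≤-trans (gap-antitone {h} {h′} H′ rest) gap-y≤gap-v
    where
      D′≤D : D {F} h′ v y ≤ D {F} h v y
      D′≤D = subst (D {F} h′ v y ≤_) (sym D≡t) (D≤t {h′} H′ vy)
      gap-y≤gap-v : gap h h′ y ≤ gap h h′ v
      gap-y≤gap-v = diff-mono (h v) (h y) (h′ v) (h′ y) D′≤D

  gap-constant : ∀ {h h′} → Height h → Height h′ → ∀ {v w} → CritEquiv F eq v w → gap h h′ v ≡ gap h h′ w
  gap-constant {h} {h′} H H′ v~w = ℤ.≤-antisym
    (gap-antitone {h} {h′} H′ (CritEquiv⇒Star-Tight {h} H (CritEquiv-sym v~w)))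
    (gap-antitone {h} {h′} H′ (CritEquiv⇒Star-Tight {h} H v~w))

  GH-resp : ∀ {h a a′ c c′} → CritEquiv F eq a a′ → CritEquiv F eq c c′ → GH F eq h a c → GH F eq h a′ c′
  GH-resp a~a′ c~c′ (a≁c , x , y , xy , x~a , y~c , tight) =
    (λ a′~c′ → a≁c (a~a′ ◅◅ a′~c′ ◅◅ CritEquiv-sym c~c′)) , x , y , xy , x~a ◅◅ a~a′ , y~c ◅◅ c~c′ , tight

  -- A class that is minimal for tight reachability has no incoming arc in G_h.
  opaque
    source-above : ∀ {h} → Height h → ∀ u → Σ (V F) λ s → Star (Tight h) s u × (∀ v → ¬ GH F eq h v s)
    source-above {h} H u =
      let s , s⇝u , minimal = TightReach.minimal-below h u
      in s , s⇝u , λ v (v≁s , x , y , xy , x~v , y~s , tight) →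
        let x⇝s = (xy , tight) ◅ CritEquiv⇒Star-Tight {h} H y~s
        in v≁s (CritEquiv-sym x~v ◅◅ Star-Tight⇒CritEquiv {h} x⇝s (minimal x x⇝s))

  FlipOf : (V F → ℤ) → V F → V F → V F → Set
  FlipOf h u v v′ = ((CritEquiv F eq v u ⊎ CritEquiv F eq v′ u) × GH F eq h v′ v)
                  ⊎ (¬ CritEquiv F eq v u × ¬ CritEquiv F eq v′ u × GH F eq h v v′)

  module UpwardFlip {h} (H : Height h) (u : V F) (u≁w0 : ¬ CritEquiv F eq u w0)
    (no-incoming : ∀ v → ¬ GH F eq h v u) where

    opaque
      raised : V F → ℤ
      raised v = raise-if (CritEquiv? {h} H v u) (h v)

      raised-inside : ∀ {v} → CritEquiv F eq v u → raised v ≡ h v + + 4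
      raised-inside {v} = raise-if-yes (CritEquiv? {h} H v u)

      raised-outside : ∀ {v} → ¬ CritEquiv F eq v u → raised v ≡ h v
      raised-outside {v} = raise-if-no (CritEquiv? {h} H v u)

      h≤raised : ∀ v → h v ≤ raised v
      h≤raised v = raise-if-≥ (CritEquiv? {h} H v u)

    -- No arc entering the class of u is tight, so each one is at its bottom value with t = b + 4.
    entering-arc : ∀ {x y} → Arc F x y → ¬ CritEquiv F eq x u → CritEquiv F eq y u →
                   D {F} h x y ≡ b x y × t x y ≡ b x y + + 4
    entering-arc {x} {y} xy x≁u y~u = by-cases (proj₂ H x y xy) (t≡b⊎t≡b+4 x y)
      where
        not-tight : ¬ D {F} h x y ≡ t x y
        not-tight D≡t = no-incoming x (x≁u , x , y , xy , ε , y~u , D≡t)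
        by-cases : D {F} h x y ≡ b x y ⊎ D {F} h x y ≡ t x y → t x y ≡ b x y ⊎ t x y ≡ b x y + + 4 →
                   D {F} h x y ≡ b x y × t x y ≡ b x y + + 4
        by-cases (inj₂ D≡t) _ = ⊥-elim (not-tight D≡t)
        by-cases (inj₁ D≡b) (inj₁ t≡b) = ⊥-elim (not-tight (trans D≡b (sym t≡b)))
        by-cases (inj₁ D≡b) (inj₂ t≡b+4) = D≡b , t≡b+4

    D-raised-inside : ∀ {x y} → CritEquiv F eq x u → CritEquiv F eq y u → D {F} raised x y ≡ D {F} h x y
    D-raised-inside {x} {y} x~u y~u = trans (cong₂ _-_ (raised-inside y~u) (raised-inside x~u))
      (solve 2 (λ a c → (c :+ con (+ 4)) :- (a :+ con (+ 4)) := c :- a) refl (h x) (h y))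

    D-raised-outside : ∀ {x y} → ¬ CritEquiv F eq x u → ¬ CritEquiv F eq y u → D {F} raised x y ≡ D {F} h x y
    D-raised-outside x≁u y≁u = cong₂ _-_ (raised-outside y≁u) (raised-outside x≁u)

    D-raised-entering : ∀ {x y} → ¬ CritEquiv F eq x u → CritEquiv F eq y u → D {F} raised x y ≡ D {F} h x y + + 4
    D-raised-entering {x} {y} x≁u y~u = trans (cong₂ _-_ (raised-inside y~u) (raised-outside x≁u))
      (solve 2 (λ a c → (c :+ con (+ 4)) :- a := (c :- a) :+ con (+ 4)) refl (h x) (h y))

    D-raised-leaving : ∀ {x y} → CritEquiv F eq x u → ¬ CritEquiv F eq y u → D {F} raised x y ≡ D {F} h x y - + 4
    D-raised-leaving {x} {y} x~u y≁u = trans (cong₂ _-_ (raised-outside y≁u) (raised-inside x~u))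
      (solve 2 (λ a c → c :- (a :+ con (+ 4)) := (c :- a) :- con (+ 4)) refl (h x) (h y))

    private
      outside : ∀ {x v} → CritEquiv F eq x v → ¬ CritEquiv F eq v u → ¬ CritEquiv F eq x u
      outside x~v v≁u x~u = v≁u (CritEquiv-sym x~v ◅◅ x~u)

      reversed-entering-tight : ∀ {x y} → Arc F x y → ¬ CritEquiv F eq x u → CritEquiv F eq y u →
                                D {F} h y x ≡ t y x
      reversed-entering-tight xy x≁u y~u = bottom⇒reverse-tight h xy (proj₁ (entering-arc xy x≁u y~u))

      entering-raised-tight : ∀ {x y} → Arc F x y → ¬ CritEquiv F eq x u → CritEquiv F eq y u →
                              D {F} raised x y ≡ t x y
      entering-raised-tight xy x≁u y~u = let D≡b , t≡b+4 = entering-arc xy x≁u y~u in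
        trans (D-raised-entering x≁u y~u) (trans (cong (_+ + 4) D≡b) (sym t≡b+4))

    raised-Height : Height raised
    raised-Height = trans (raised-outside (λ w0~u → u≁w0 (CritEquiv-sym w0~u))) (proj₁ H) , λ x y xy →
      by-cases xy (CritEquiv? {h} H x u) (CritEquiv? {h} H y u)
      where
        by-cases : ∀ {x y} → Arc F x y → Dec (CritEquiv F eq x u) → Dec (CritEquiv F eq y u) →
                   D {F} raised x y ≡ b x y ⊎ D {F} raised x y ≡ t x y
        by-cases {x} {y} xy (yes x~u) (yes y~u) =
          subst (λ d → d ≡ b x y ⊎ d ≡ t x y) (sym (D-raised-inside x~u y~u)) (proj₂ H x y xy)
        by-cases {x} {y} xy (no x≁u) (no y≁u) =
          subst (λ d → d ≡ b x y ⊎ d ≡ t x y) (sym (D-raised-outside x≁u y≁u)) (proj₂ H x y xy)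
        by-cases xy (no x≁u) (yes y~u) = inj₂ (entering-raised-tight xy x≁u y~u)
        by-cases {x} {y} xy (yes x~u) (no y≁u) = inj₁ (reverse-tight⇒bottom raised xy (begin
          D {F} raised y x   ≡⟨ D-raised-entering y≁u x~u ⟩
          D {F} h y x + + 4  ≡⟨ cong (_+ + 4) D≡b ⟩
          b y x + + 4        ≡⟨ sym t≡b+4 ⟩
          t y x              ∎))
          where
            open ≡-Reasoning
            D≡b = proj₁ (entering-arc (Arc-sym x y xy) y≁u x~u)
            t≡b+4 = proj₂ (entering-arc (Arc-sym x y xy) y≁u x~u)

    private
      leaving-not-tight : ∀ {x y} → Arc F x y → CritEquiv F eq x u → ¬ CritEquiv F eq y u → ¬ D {F} raised x y ≡ t x y
      leaving-not-tight {x} {y} xy x~u y≁u tight = a+4≰a (t x y) (subst (_≤ t x y) D≡t+4 (D≤t {h} H xy))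
        where
          D≡t+4 : D {F} h x y ≡ t x y + + 4
          D≡t+4 = trans (solve 1 (λ z → z := (z :- con (+ 4)) :+ con (+ 4)) refl (D {F} h x y))
                        (cong (_+ + 4) (trans (sym (D-raised-leaving x~u y≁u)) tight))

    raised-graph : ∀ v v′ → GH F eq raised v v′ ⇔ FlipOf h u v v′
    raised-graph v v′ = by-cases (CritEquiv? {h} H v u) (CritEquiv? {h} H v′ u)
      where
        by-cases : Dec (CritEquiv F eq v u) → Dec (CritEquiv F eq v′ u) → GH F eq raised v v′ ⇔ FlipOf h u v v′
        by-cases (yes v~u) (yes v′~u) = mk⇔
          (λ (v≁v′ , _) → ⊥-elim (v≁v′ (v~u ◅◅ CritEquiv-sym v′~u)))
          λ { (inj₁ (_ , v′≁v , _)) → ⊥-elim (v′≁v (v′~u ◅◅ CritEquiv-sym v~u))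
            ; (inj₂ (v≁u , _)) → ⊥-elim (v≁u v~u) }
        by-cases (no v≁u) (no v′≁u) = mk⇔
          (λ (v≁v′ , x , y , xy , x~v , y~v′ , tight) → inj₂ (v≁u , v′≁u ,
            (v≁v′ , x , y , xy , x~v , y~v′ , trans (sym (D-raised-outside (outside x~v v≁u) (outside y~v′ v′≁u))) tight)))
          λ { (inj₁ (inj₁ v~u , _)) → ⊥-elim (v≁u v~u)
            ; (inj₁ (inj₂ v′~u , _)) → ⊥-elim (v′≁u v′~u)
            ; (inj₂ (_ , _ , (v≁v′ , x , y , xy , x~v , y~v′ , tight))) →
                v≁v′ , x , y , xy , x~v , y~v′ , trans (D-raised-outside (outside x~v v≁u) (outside y~v′ v′≁u)) tight }
        by-cases (yes v~u) (no v′≁u) = mk⇔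
          (λ (_ , x , y , xy , x~v , y~v′ , tight) → ⊥-elim (leaving-not-tight xy (x~v ◅◅ v~u) (outside y~v′ v′≁u) tight))
          λ { (inj₁ (_ , g)) → ⊥-elim (no-incoming v′ (GH-resp {h} ε v~u g))
            ; (inj₂ (v≁u , _)) → ⊥-elim (v≁u v~u) }
        by-cases (no v≁u) (yes v′~u) = mk⇔
          (λ (_ , x , y , xy , x~v , y~v′ , _) → inj₁ (inj₂ v′~u ,
            (λ v′~v → v≁u (CritEquiv-sym v′~v ◅◅ v′~u)) , y , x , Arc-sym x y xy , y~v′ , x~v ,
            reversed-entering-tight xy (outside x~v v≁u) (y~v′ ◅◅ v′~u)))
          λ { (inj₁ (_ , (_ , y , x , yx , y~v′ , x~v , _))) →
                (λ v~v′ → v≁u (v~v′ ◅◅ v′~u)) , x , y , Arc-sym y x yx , x~v , y~v′ ,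
                entering-raised-tight (Arc-sym y x yx) (outside x~v v≁u) (y~v′ ◅◅ v′~u)
            ; (inj₂ (_ , v′≁u , _)) → ⊥-elim (v′≁u v′~u) }

    upward-flip : UpFlip F eq w0 (GH F eq h) (GH F eq raised)
    upward-flip = u , u≁w0 , no-incoming , raised-graph

  -- If G_h ⊆ G_h′, an arc between two classes that is tight for h is tight for h′: otherwise its
  -- reverse would be tight for h′, making the two classes mutually tight-reachable.
  tight-across : ∀ {h h′} → Height h′ → (∀ a c → GH F eq h a c → GH F eq h′ a c) →
                 ∀ {x y} → Arc F x y → ¬ CritEquiv F eq x y → D {F} h x y ≡ t x y → D {F} h′ x y ≡ t x y
  tight-across {h} {h′} H′ G⊆G′ {x} {y} xy x≁y D≡t = by-cases (proj₂ H′ x y xy) (t≡b⊎t≡b+4 x y)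
    where
      by-cases : D {F} h′ x y ≡ b x y ⊎ D {F} h′ x y ≡ t x y → t x y ≡ b x y ⊎ t x y ≡ b x y + + 4 →
                 D {F} h′ x y ≡ t x y
      by-cases (inj₂ D′≡t) _ = D′≡t
      by-cases (inj₁ D′≡b) (inj₁ t≡b) = trans D′≡b (sym t≡b)
      by-cases (inj₁ D′≡b) (inj₂ _) =
        let _ , x′ , y′ , x′y′ , x′~x , y′~y , tight′ = G⊆G′ x y (x≁y , x , y , xy , ε , ε , D≡t)
            x⇝y = CritEquiv⇒Star-Tight {h′} H′ (CritEquiv-sym x′~x) ◅◅ ((x′y′ , tight′) ◅ CritEquiv⇒Star-Tight {h′} H′ y′~y)
            y⇝x = (Arc-sym x y xy , bottom⇒reverse-tight h′ xy D′≡b) ◅ ε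
        in ⊥-elim (x≁y (Star-Tight⇒CritEquiv {h′} x⇝y y⇝x))

  same-graph⇒same-D : ∀ {h h′} → Height h → Height h′ → SameGraph F (GH F eq h) (GH F eq h′) →
                      ∀ {x y} → Arc F x y → D {F} h x y ≡ D {F} h′ x y
  same-graph⇒same-D {h} {h′} H H′ same {x} {y} xy = by-cases (CritEquiv? {h} H x y)
    where
      G⊆G′ = λ a c → Equivalence.to (same a c)
      by-cases : Dec (CritEquiv F eq x y) → D {F} h x y ≡ D {F} h′ x y
      by-cases (yes x~y) = diff-swap (h x) (h′ x) (h y) (h′ y) (gap-constant {h} {h′} H H′ x~y)
      by-cases (no x≁y) = across (proj₂ H x y xy) (t≡b⊎t≡b+4 x y)
        where
          across : D {F} h x y ≡ b x y ⊎ D {F} h x y ≡ t x y → t x y ≡ b x y ⊎ t x y ≡ b x y + + 4 →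
                   D {F} h x y ≡ D {F} h′ x y
          across (inj₂ D≡t) _ = trans D≡t (sym (tight-across {h} {h′} H′ G⊆G′ xy x≁y D≡t))
          across (inj₁ D≡b) (inj₁ t≡b) = trans D≡t (sym (tight-across {h} {h′} H′ G⊆G′ xy x≁y D≡t))
            where D≡t = trans D≡b (sym t≡b)
          across (inj₁ D≡b) (inj₂ _) = trans D≡b (sym (reverse-tight⇒bottom h′ xy
            (tight-across {h} {h′} H′ G⊆G′ (Arc-sym x y xy) (λ y~x → x≁y (CritEquiv-sym y~x)) (bottom⇒reverse-tight h xy D≡b))))

  GH-injective : ∀ {h h′} → Height h → Height h′ → SameGraph F (GH F eq h) (GH F eq h′) → ∀ v → h v ≡ h′ v
  GH-injective {h} {h′} H H′ same v = sym (ℤ.i-j≡0⇒i≡j (h′ v) (h v) (trans (sym (along (Arc-connected w0 v))) (gap-w0 {h} {h′} H H′)))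
    where
      along : ∀ {x y} → Star (Arc F) x y → gap h h′ x ≡ gap h h′ y
      along ε = refl
      along {x} (_◅_ {j = y} xy rest) =
        trans (diff-swap (h x) (h y) (h′ x) (h′ y) (same-graph⇒same-D {h} {h′} H H′ same xy)) (along rest)

  UpFlip⇒≤ : ∀ {h h₁} → Height h → Height h₁ → UpFlip F eq w0 (GH F eq h) (GH F eq h₁) → ∀ v → h v ≤ h₁ v
  UpFlip⇒≤ {h} {h₁} H H₁ (u , u≁w0 , no-incoming , G₁≡flip) v =
    ℤ.≤-trans (h≤raised v) (ℤ.≤-reflexive (GH-injective {raised} {h₁} raised-Height H₁ same v))
    where
      open UpwardFlip {h} H u u≁w0 no-incoming
      same : SameGraph F (GH F eq raised) (GH F eq h₁)
      same a c = mk⇔ (Equivalence.from (G₁≡flip a c) ∘ Equivalence.to (raised-graph a c))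
                     (Equivalence.from (raised-graph a c) ∘ Equivalence.to (G₁≡flip a c))

  FlipPath⇒≤ : ∀ {p h h′} → Height h → Height h′ → FlipPath F eq w0 (GH F eq h) (GH F eq h′) p → ∀ v → h v ≤ h′ v
  FlipPath⇒≤ {h = h} {h′} H H′ (done same) v = ℤ.≤-reflexive (GH-injective {h} {h′} H H′ same v)
  FlipPath⇒≤ {h = h} {h′} H H′ (step h₁ H₁ flip rest) v =
    ℤ.≤-trans (UpFlip⇒≤ {h} {h₁} H H₁ flip v) (FlipPath⇒≤ {h = h₁} {h′} H₁ H′ rest v)

  D≡b+4* : ∀ h → Height h → ∀ {x y} → Arc F x y → Σ ℤ λ δ → D {F} h x y ≡ b x y + + 4 ℤ.* δ
  D≡b+4* h (_ , steps) {x} {y} xy with steps x y xy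
  ... | inj₁ D≡b = + 0 , trans D≡b (sym (ℤ.+-identityʳ (b x y)))
  ... | inj₂ D≡t with t≡b⊎t≡b+4 x y
  ...   | inj₁ t≡b = + 0 , trans D≡t (trans t≡b (sym (ℤ.+-identityʳ (b x y))))
  ...   | inj₂ t≡b+4 = + 1 , trans D≡t t≡b+4

  gap-multiple-of-4 : ∀ {h h′} → Height h → Height h′ → ∀ v → Σ ℤ λ z → gap h h′ v ≡ + 4 ℤ.* z
  gap-multiple-of-4 {h} {h′} H H′ v = along (Arc-connected w0 v) (+ 0 , gap-w0 {h} {h′} H H′)
    where
      along : ∀ {x y} → Star (Arc F) x y → Σ ℤ (λ z → gap h h′ x ≡ + 4 ℤ.* z) → Σ ℤ λ z → gap h h′ y ≡ + 4 ℤ.* z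
      along ε gx = gx
      along {x} (_◅_ {j = y} xy rest) (z , gx≡4z) = along rest (z + (δ′ - δ) , (begin
        h′ y - h y                                      ≡⟨ solve 4 (λ hx hy h′x h′y → h′y :- hy := (h′x :- hx) :+ ((h′y :- h′x) :- (hy :- hx))) refl (h x) (h y) (h′ x) (h′ y) ⟩
        gap h h′ x + (D {F} h′ x y - D {F} h x y)       ≡⟨ cong₂ (λ p q → p + (q - D {F} h x y)) gx≡4z D′≡ ⟩
        + 4 ℤ.* z + ((b x y + + 4 ℤ.* δ′) - D {F} h x y)    ≡⟨ cong (λ q → + 4 ℤ.* z + ((b x y + + 4 ℤ.* δ′) - q)) D≡ ⟩
        + 4 ℤ.* z + ((b x y + + 4 ℤ.* δ′) - (b x y + + 4 ℤ.* δ)) ≡⟨ solve 4 (λ z bb d′ d → con (+ 4) :* z :+ ((bb :+ con (+ 4) :* d′) :- (bb :+ con (+ 4) :* d)) := con (+ 4) :* (z :+ (d′ :- d))) refl z (b x y) δ′ δ ⟩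
        + 4 ℤ.* (z + (δ′ - δ))                            ∎))
        where
          open ≡-Reasoning
          δ = proj₁ (D≡b+4* h H xy)
          D≡ = proj₂ (D≡b+4* h H xy)
          δ′ = proj₁ (D≡b+4* h′ H′ xy)
          D′≡ = proj₂ (D≡b+4* h′ H′ xy)

  4≤gap : ∀ {h h′} → Height h → Height h′ → ∀ {v} → h v ≤ h′ v → h v ≢ h′ v → + 4 ≤ gap h h′ v
  4≤gap {h} {h′} H H′ {v} h≤h′ h≢h′ =
    let z , gap≡4z = gap-multiple-of-4 {h} {h′} H H′ v
    in subst (+ 4 ≤_) (sym gap≡4z) (4*z≢0⇒4≤4*z z (subst (+ 0 ≤_) gap≡4z (ℤ.i≤j⇒0≤j-i h≤h′))
         (λ 4z≡0 → h≢h′ (sym (ℤ.i-j≡0⇒i≡j (h′ v) (h v) (trans gap≡4z 4z≡0)))))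

  module Towards (h′ : V F → ℤ) (H′ : Height h′) where

    dist : (V F → ℤ) → V F → ℕ
    dist h v = ∣ h v - h′ v ∣

    distance : (V F → ℤ) → ℕ
    distance h = sum (map (dist h) vertices)

    module Step {h} (H : Height h) (h≤h′ : ∀ v → h v ≤ h′ v) {v0 : V F} (h≢h′ : h v0 ≢ h′ v0)
      {s : V F} (s⇝v0 : Star (Tight h) s v0) (no-incoming : ∀ v → ¬ GH F eq h v s) where

      4≤gap-class : ∀ {v} → CritEquiv F eq v s → + 4 ≤ gap h h′ v
      4≤gap-class v~s = subst (+ 4 ≤_) (sym (gap-constant {h} {h′} H H′ v~s))
        (ℤ.≤-trans (4≤gap {h} {h′} H H′ (h≤h′ v0) h≢h′) (gap-antitone {h} {h′} H′ s⇝v0))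

      s≁w0 : ¬ CritEquiv F eq s w0
      s≁w0 s~w0 = 4≰0 (subst (+ 4 ≤_) (trans (gap-constant {h} {h′} H H′ s~w0) (gap-w0 {h} {h′} H H′))
                           (4≤gap-class ε))
        where
          4≰0 : ¬ (+ 4 ≤ + 0)
          4≰0 (+≤+ ())

      open UpwardFlip {h} H s s≁w0 no-incoming public

      h+4≤h′ : ∀ {v} → CritEquiv F eq v s → h v + + 4 ≤ h′ v
      h+4≤h′ {v} v~s = subst (h v + + 4 ≤_) (solve 2 (λ a c → a :+ (c :- a) := c) refl (h v) (h′ v))
        (ℤ.+-monoʳ-≤ (h v) (4≤gap-class v~s))

      raised≤h′ : ∀ v → raised v ≤ h′ v
      raised≤h′ v = by-cases (CritEquiv? {h} H v s)
        where
          by-cases : Dec (CritEquiv F eq v s) → raised v ≤ h′ v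
          by-cases (yes v~s) = subst (_≤ h′ v) (sym (raised-inside v~s)) (h+4≤h′ v~s)
          by-cases (no v≁s) = subst (_≤ h′ v) (sym (raised-outside v≁s)) (h≤h′ v)

      dist-inside : ∀ {v} → CritEquiv F eq v s → dist raised v ℕ.+ 4 ≡ dist h v
      dist-inside {v} v~s = trans (cong (λ z → ∣ z - h′ v ∣ ℕ.+ 4) (raised-inside v~s))
                                  (∣a+4-c∣+4≡∣a-c∣ (h v) (h′ v) (h+4≤h′ v~s))

      dist-outside : ∀ {v} → ¬ CritEquiv F eq v s → dist raised v ≡ dist h v
      dist-outside {v} v≁s = cong (λ z → ∣ z - h′ v ∣) (raised-outside v≁s)

      dist-≤ : ∀ v → dist raised v ℕ.≤ dist h v
      dist-≤ v = by-cases (CritEquiv? {h} H v s)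
        where
          by-cases : Dec (CritEquiv F eq v s) → dist raised v ℕ.≤ dist h v
          by-cases (yes v~s) = subst (dist raised v ℕ.≤_) (dist-inside v~s) (ℕ.m≤m+n _ 4)
          by-cases (no v≁s) = ℕ.≤-reflexive (dist-outside v≁s)

      distance-< : distance raised ℕ.< distance h
      distance-< = sum-mono-< (dist raised) (dist h) dist-≤ (∈-vertices s)
        (subst (dist raised s ℕ.<_) (dist-inside ε) (ℕ.m<m+n _ (s≤s z≤n)))

      Δ-step : ∀ reps → Any (CritEquiv F eq s) reps → AllPairs (λ r r′ → ¬ CritEquiv F eq r r′) reps →
               Δ {F} reps raised h′ ℕ.+ 4 ≡ Δ {F} reps h h′
      Δ-step (r ∷ rs) s~some (r≁rs ∷ distinct) = by-cases (CritEquiv? {h} H r s) s~some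
        where
          others-unchanged : ∀ {rs} → All (λ r′ → ¬ CritEquiv F eq r′ s) rs → Δ {F} rs raised h′ ≡ Δ {F} rs h h′
          others-unchanged [] = refl
          others-unchanged (r′≁s ∷ rest) = cong₂ ℕ._+_ (dist-outside r′≁s) (others-unchanged rest)
          by-cases : Dec (CritEquiv F eq r s) → Any (CritEquiv F eq s) (r ∷ rs) →
                     Δ {F} (r ∷ rs) raised h′ ℕ.+ 4 ≡ Δ {F} (r ∷ rs) h h′
          by-cases (yes r~s) _ = trans (+-right-comm (dist raised r) _ 4)
            (cong₂ ℕ._+_ (dist-inside r~s) (others-unchanged (All.map (λ r≁r′ r′~s → r≁r′ (r~s ◅◅ CritEquiv-sym r′~s)) r≁rs)))
          by-cases (no r≁s) (here s~r) = ⊥-elim (r≁s (CritEquiv-sym s~r))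
          by-cases (no r≁s) (there s~rs) = trans (ℕ.+-assoc (dist raised r) _ 4)
            (cong₂ ℕ._+_ (dist-outside r≁s) (Δ-step rs s~rs distinct))

    Result : (V F → ℤ) → Set₁
    Result h = Σ ℕ λ p → FlipPath F eq w0 (GH F eq h) (GH F eq h′) p ×
                         (∀ reps → Representatives F eq reps → 4 * p ≡ Δ {F} reps h h′)

    GH-cong : ∀ {h} → (∀ v → h v ≡ h′ v) → SameGraph F (GH F eq h) (GH F eq h′)
    GH-cong {h} h≡h′ a c = mk⇔ (λ (a≁c , x , y , xy , x~a , y~c , tight) → a≁c , x , y , xy , x~a , y~c , trans (sym (same-D x y)) tight)
                                (λ (a≁c , x , y , xy , x~a , y~c , tight) → a≁c , x , y , xy , x~a , y~c , trans (same-D x y) tight)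
      where
        same-D : ∀ x y → D {F} h x y ≡ D {F} h′ x y
        same-D x y = cong₂ _-_ (h≡h′ y) (h≡h′ x)

    Δ-zero : ∀ {h} → (∀ v → h v ≡ h′ v) → ∀ reps → Δ {F} reps h h′ ≡ 0
    Δ-zero h≡h′ [] = refl
    Δ-zero {h} h≡h′ (r ∷ rs) = cong₂ ℕ._+_ (cong ∣_∣ (trans (cong (_- h′ r) (h≡h′ r)) (ℤ.+-inverseʳ (h′ r)))) (Δ-zero h≡h′ rs)

    forward : ∀ h → Height h → (∀ v → h v ≤ h′ v) → Acc ℕ._<_ (distance h) → Result h
    forward h H h≤h′ (acc smaller) = by-cases (All.all? (λ v → h v ℤ.≟ h′ v) vertices)
      where
        by-cases : Dec (All (λ v → h v ≡ h′ v) vertices) → Result h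
        by-cases (yes all-equal) = 0 , done (GH-cong h≡h′) , λ reps _ → sym (Δ-zero h≡h′ reps)
          where
            h≡h′ : ∀ v → h v ≡ h′ v
            h≡h′ v = All.lookup all-equal (∈-vertices v)
        by-cases (no ¬all-equal) =
          let v0 , _ , h≢h′ = find (All.¬All⇒Any¬ (λ v → h v ℤ.≟ h′ v) vertices ¬all-equal)
              s , s⇝v0 , no-incoming = source-above {h} H v0
              open Step {h} H h≤h′ h≢h′ s⇝v0 no-incoming
              p , path , 4p≡Δ = forward raised raised-Height raised≤h′ (smaller distance-<)
          in suc p , step raised raised-Height upward-flip path , λ reps R@(s~some , distinct) → begin
            4 * suc p                   ≡⟨ ℕ.*-suc 4 p ⟩
            4 ℕ.+ 4 * p                 ≡⟨ ℕ.+-comm 4 _ ⟩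
            4 * p ℕ.+ 4                 ≡⟨ cong (ℕ._+ 4) (4p≡Δ reps R) ⟩
            Δ {F} reps raised h′ ℕ.+ 4  ≡⟨ Δ-step reps (s~some s) distinct ⟩
            Δ {F} reps h h′             ∎
          where open ≡-Reasoning

    flip-sequence : ∀ {h} → Height h → (∀ v → h v ≤ h′ v) → Result h
    flip-sequence {h} H h≤h′ = forward h H h≤h′ (<-wellFounded _)

mainTheorem7 : (F : Figure) (eq : V F → V F → ℤ) → Equilibrium F eq →
  (w0 : V F) → OnBoundaryHinf F w0 →
  (h h' : V F → ℤ) → IsHeight F eq w0 h → IsHeight F eq w0 h' →
  (((∀ v → h v ≤ h' v) ⇔ FlipLE F eq w0 h h') ×
   ((∀ v → h v ≤ h' v) →
     (reps : List (V F)) → Representatives F eq reps →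
     Σ ℕ (λ p → FlipPath F eq w0 (GH F eq h) (GH F eq h') p ×
                4 * p ≡ Δ {F} reps h h')))
mainTheorem7 F eq (eq-antisym , _) w0 _ h h′ H H′ =
  mk⇔ (λ h≤h′ → let p , path , _ = flip-sequence H h≤h′ in p , path)
      (λ (_ , path) → FlipPath⇒≤ {h = h} {h′} H H′ path) ,
  λ h≤h′ reps R → let p , path , 4p≡Δ = flip-sequence H h≤h′ in p , path , 4p≡Δ reps R
  where
    open Heights F eq eq-antisym w0
    open Towards h′ H′
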